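{- Let $G$ be a graph on $n$ vertices with degree sequence $d_1\ge d_2\ge\cdots\ge d_n$ and let $m=\max\{i:d_i\ge i-1\}$. Then $G$ is an NG-3 graph if and only if (i) $\sum_{i=1}^{m+2} d_i=(m+2)(m+1)-10+\sum_{i=m+3}^n d_i$, and (ii) for every index $i$, $d_i=m-1$ if and only if $m-2\le i\le m+2$.
   Context: Graphs are finite and simple; $\chi$ is chromatic number and $\overline{G}$ the complement. A graph $G$ is an NG-graph if $\chi(G)+\chi(\overline{G})=|V(G)|+1$. The ABC-partition of $V(G)$ is $A=\{v:\deg(v)=\chi(G)-1\}$, $B=\{v:\deg(v)>\chi(G)-1\}$, $C=\{v:\deg(v)<\chi(G)-1\}$. An NG-3 graph is an NG-graph in which $G[A]$ induces a 5-cycle. -}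

module Defs where

open import Data.Nat using (ℕ; zero; suc; _+_; _*_; _∸_; _≤_; _%_; _≡ᵇ_)
open import Data.Bool using (Bool; true; false; if_then_else_; not; _∧_; _∨_)
open import Data.Fin using (Fin; toℕ)
import Data.Fin as Fin
open import Data.Fin.Permutation using (Permutation′; _⟨$⟩ʳ_)
open import Data.List using (List; map; upTo; allFin)
open import Data.Nat.ListAction using (sum)
open import Data.Product using (Σ; ∃; ∃₂; _×_)
open import Relation.Nullary using (¬_; does)
open import Relation.Binary.PropositionalEquality using (_≡_; _≢_)
open import Function.Definitions using (Injective)
open import Function.Bundles using (_⇔_)

record Graph (n : ℕ) : Set where
  field
    adj    : Fin n → Fin n → Bool
    sym    : ∀ u v → adj u v ≡ adj v u
    irrefl : ∀ v → adj v v ≡ false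
open Graph public

complAdj : ∀ {n} → Graph n → Fin n → Fin n → Bool
complAdj G u v = not (does (u Fin.≟ v)) ∧ not (adj G u v)

Colorable : ∀ {n} → (Fin n → Fin n → Bool) → ℕ → Set
Colorable {n} a k =
  Σ (Fin n → Fin k) λ c → ∀ u v → a u v ≡ true → c u ≢ c v

IsChromaticNumber : ∀ {n} → (Fin n → Fin n → Bool) → ℕ → Set
IsChromaticNumber a k = Colorable a k × (∀ j → Colorable a j → k ≤ j)

IsNG : ∀ {n} → Graph n → Set
IsNG {n} G = ∃₂ λ k l →
  IsChromaticNumber (adj G) k × IsChromaticNumber (complAdj G) l × k + l ≡ n + 1

deg : ∀ {n} → Graph n → Fin n → ℕ
deg {n} G v = sum (map (λ u → if adj G v u then 1 else 0) (allFin n))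

c5adj : Fin 5 → Fin 5 → Bool
c5adj i j = (toℕ j ≡ᵇ (suc (toℕ i) % 5)) ∨ (toℕ i ≡ᵇ (suc (toℕ j) % 5))

InducesC5 : ∀ {n} → Graph n → (Fin n → Set) → Set
InducesC5 {n} G S =
  Σ (Fin 5 → Fin n) λ f →
    Injective _≡_ _≡_ f ×
    (∀ v → S v ⇔ ∃ λ i → f i ≡ v) ×
    (∀ i j → adj G (f i) (f j) ≡ c5adj i j)

-- The set A of the ABC-partition, for χ(G) = k
SetA : ∀ {n} → Graph n → ℕ → Fin n → Set
SetA G k v = deg G v ≡ k ∸ 1

IsNG3 : ∀ {n} → Graph n → Set
IsNG3 G = IsNG G × Σ ℕ λ k → IsChromaticNumber (adj G) k × InducesC5 G (SetA G k)

-- Values of d outside 1..n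
-- are irrelevant.

IsDegreeSequence : ∀ {n} → Graph n → (ℕ → ℕ) → Set
IsDegreeSequence {n} G d =
  Σ (Permutation′ n) (λ σ → ∀ (i : Fin n) → d (suc (toℕ i)) ≡ deg G (σ ⟨$⟩ʳ i)) ×
  (∀ i j → 1 ≤ i → i ≤ j → j ≤ n → d j ≤ d i)

IsMaxIndex : ℕ → (ℕ → ℕ) → ℕ → Set
IsMaxIndex n d m =
  (1 ≤ m × m ≤ n × m ∸ 1 ≤ d m) ×
  (∀ i → 1 ≤ i → i ≤ n → i ∸ 1 ≤ d i → i ≤ m)

-- Σ_{i=a}^{b} d i  (empty when b < a)
sumFromTo : (ℕ → ℕ) → ℕ → ℕ → ℕ
sumFromTo d a b = sum (map (λ k → d (a + k)) (upTo (suc b ∸ a)))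

-- (i) Σ_{i=1}^{m+2} d i = (m+2)(m+1) - 10 + Σ_{i=m+3}^{n} d i
--     (rearranged to avoid truncated subtraction; the indices 1..m+2
--      must be valid, i.e. m + 2 ≤ n)
ConditionI : ℕ → (ℕ → ℕ) → ℕ → Set
ConditionI n d m =
  m + 2 ≤ n ×
  sumFromTo d 1 (m + 2) + 10 ≡ (m + 2) * (m + 1) + sumFromTo d (m + 3) n

-- (ii) for every index i ∈ {1..n}: d i = m - 1  iff  m - 2 ≤ i ≤ m + 2
--      (d i = m - 1 written as d i + 1 ≡ m, m - 2 ≤ i as m ≤ i + 2)
ConditionII : ℕ → (ℕ → ℕ) → ℕ → Set
ConditionII n d m =
  ∀ i → 1 ≤ i → i ≤ n → (d i + 1 ≡ m ⇔ (m ≤ i + 2 × i ≤ m + 2))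

module Submission where

-- Relabel G along its degree sequence so that degrees decrease with the
-- position.  If G is NG-3 with χ(G) = k, χ(Ḡ) = l, the vertices of degree
-- k - 1 (a 5-cycle A) occupy positions [p, p + 5); B lies below, C (N
-- vertices) above.  Colouring B by labels, A by 3 colours and the rest
-- greedily gives χ(G) ≤ p + 3, dually χ(Ḡ) ≤ N + 3, and k + l = n + 1
-- forces equality; refined (p + 2)-colourings then show B is a clique
-- joined to A and C is independent and anticomplete to A.  Counting the
-- rows of the first p + 5 vertices gives (i), and m = p + 3 gives (ii).
-- Conversely (i), (ii) force m = p + 3 ≥ 3, make each row meet an upper
-- bound with equality, and thus rebuild the same structure with A
-- 2-regular, hence a 5-cycle; the colourings and a lower bound for a
-- clique joined to C₅ give χ(G) = p + 3 and χ(Ḡ) = N + 3.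
-- Sections: sums and counting; greedy colouring; C₅; clique + C₅ colourings;
-- row decomposition; complements and relabelling; sorted graphs; the two
-- directions; the theorem.

open import Defs
open import Data.Nat using (ℕ; zero; suc; _+_; _*_; _∸_; _≤_; _<_; z≤n; s≤s; _<?_; _≤?_; _%_; _≡ᵇ_)
open import Data.Bool using (Bool; true; false; if_then_else_; not; _∧_; _∨_)
open import Data.Fin using (Fin; zero; suc; toℕ; fromℕ<; splitAt)
open import Data.Fin.Patterns using (0F; 1F; 2F; 3F; 4F; 5F; 6F; 7F; 8F; 9F)
open import Data.List using (List; []; _∷_; map; allFin; tabulate; applyUpTo)
open import Data.Nat.ListAction using (sum)
open import Data.Product using (Σ; ∃; _×_; _,_; proj₁; proj₂)
open import Data.Sum using (_⊎_; inj₁; inj₂)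
open import Data.Empty using (⊥; ⊥-elim)
open import Relation.Nullary using (¬_; Dec; yes; no; does)
open import Function using (_∘_; id)
open import Relation.Binary using (tri<; tri≈; tri>)
open import Relation.Nullary.Decidable using (dec-true; dec-false)
open import Data.Fin.Permutation using (Permutation′; _⟨$⟩ʳ_; _⟨$⟩ˡ_; inverseˡ; inverseʳ)
open import Function.Bundles using (_⇔_; mk⇔; Equivalence)
open import Function.Construct.Composition using (_⇔-∘_)
open import Data.Vec using (Vec; []; _∷_; lookup)
open import Data.Maybe using (Maybe; just; nothing; is-just)
open import Data.Nat.Tactic.RingSolver using (solve-∀)
import Data.Nat.Properties as ℕP
import Data.Fin as Fin
import Data.Fin.Properties as FP
open import Relation.Binary.PropositionalEquality renaming (sym to esym)
import Data.Fin.Permutation as Perm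
open import Algebra.Properties.Semiring.Sum ℕP.+-*-semiring
  using (∑-distrib-+; ∑-comm; ∑-permute; sum-cong-≗; sum-replicate-zero; *-distribˡ-sum; *-distribʳ-sum)
  renaming (sum to ∑)

-- Sums over Fin n and counting

𝟙 : Bool → ℕ
𝟙 b = if b then 1 else 0

𝟙≤1 : ∀ b → 𝟙 b ≤ 1
𝟙≤1 true = s≤s z≤n
𝟙≤1 false = z≤n

sum-applyUpTo : ∀ n (g : ℕ → ℕ) (h : ℕ → ℕ) → sum (map g (applyUpTo h n)) ≡ ∑ {n} (λ i → g (h (toℕ i)))
sum-applyUpTo zero g h = refl
sum-applyUpTo (suc n) g h = cong (g (h 0) +_) (sum-applyUpTo n g (h ∘ suc))

sum-allFin : ∀ {n} (f : Fin n → ℕ) → sum (map f (allFin n)) ≡ ∑ f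
sum-allFin f = trans (cong sum (map-tabulate id)) (sum-tabulate f)
  where
  map-tabulate : ∀ {n} (h : Fin n → Fin _) → map f (tabulate h) ≡ tabulate (f ∘ h)
  map-tabulate {zero} h = refl
  map-tabulate {suc n} h = cong (f (h zero) ∷_) (map-tabulate (h ∘ suc))
  sum-tabulate : ∀ {n} (g : Fin n → ℕ) → sum (tabulate g) ≡ ∑ g
  sum-tabulate {zero} g = refl
  sum-tabulate {suc n} g = cong (g zero +_) (sum-tabulate (g ∘ suc))

degOf : ∀ {n} → (Fin n → Fin n → Bool) → Fin n → ℕ
degOf a v = ∑ (λ u → 𝟙 (a v u))

deg≡degOf : ∀ {n} (G : Graph n) v → deg G v ≡ degOf (adj G) v
deg≡degOf G v = sum-allFin (λ u → if adj G v u then 1 else 0)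

∑-cong : ∀ {n} {f g : Fin n → ℕ} → (∀ i → f i ≡ g i) → ∑ f ≡ ∑ g
∑-cong = sum-cong-≗

∑-zero : ∀ {n} → ∑ {n} (λ _ → 0) ≡ 0
∑-zero {n} = sum-replicate-zero n

∑-*ʳ : ∀ {n} (f : Fin n → ℕ) c → ∑ (λ i → f i * c) ≡ ∑ f * c
∑-*ʳ f c = esym (*-distribʳ-sum c f)

∑-mono : ∀ {n} {f g : Fin n → ℕ} → (∀ i → f i ≤ g i) → ∑ f ≤ ∑ g
∑-mono {zero} e = z≤n
∑-mono {suc n} e = ℕP.+-mono-≤ (e zero) (∑-mono (e ∘ suc))

∑-≤-≡⇒≡ : ∀ {n} {f g : Fin n → ℕ} → (∀ i → f i ≤ g i) → ∑ f ≡ ∑ g → ∀ i → f i ≡ g i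
∑-≤-≡⇒≡ {suc n} {f} {g} le eq zero with ℕP.m≤n⇒m<n∨m≡n (le zero)
... | inj₂ e = e
... | inj₁ lt = ⊥-elim (ℕP.<⇒≢ (ℕP.+-mono-<-≤ lt (∑-mono (le ∘ suc))) eq)
∑-≤-≡⇒≡ {suc n} {f} {g} le eq (suc i) =
  ∑-≤-≡⇒≡ (le ∘ suc) (ℕP.+-cancelˡ-≡ (f zero) (∑ (f ∘ suc)) (∑ (g ∘ suc))
    (trans eq (cong (_+ ∑ (g ∘ suc)) (esym (∑-≤-≡⇒≡ le eq zero))))) i

∑≡0⇒≡0 : ∀ {n} {f : Fin n → ℕ} → ∑ f ≡ 0 → ∀ i → f i ≡ 0
∑≡0⇒≡0 {n} e i = esym (∑-≤-≡⇒≡ (λ _ → z≤n) (trans (∑-zero {n}) (esym e)) i)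

∑-one : ∀ {n} → ∑ {n} (λ _ → 1) ≡ n
∑-one {zero} = refl
∑-one {suc n} = cong suc (∑-one {n})

ltb : ℕ → ℕ → Bool
ltb m t = does (m <? t)

eqb : ∀ {n} → Fin n → Fin n → Bool
eqb i j = does (i Fin.≟ j)

count-below : ∀ {n} t → t ≤ n → ∑ {n} (λ i → 𝟙 (ltb (toℕ i) t)) ≡ t
count-below {n} zero le = ∑-zero {n}
count-below {suc n} (suc t) (s≤s le) = cong suc (trans (∑-cong shift) (count-below t le))
  where
  shift : ∀ (i : Fin n) → 𝟙 (ltb (suc (toℕ i)) (suc t)) ≡ 𝟙 (ltb (toℕ i) t)
  shift i with toℕ i <? t
  ... | yes _ = refl
  ... | no _ = refl

count-equal : ∀ {n} (i : Fin n) → ∑ (λ j → 𝟙 (eqb j i)) ≡ 1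
count-equal {suc n} zero = cong suc (∑-zero {n})
count-equal {suc n} (suc i) = count-equal i

f≢t : false ≡ true → ⊥
f≢t ()

predF : ∀ {n} (j : Fin (suc n)) → j ≢ zero → Fin n
predF zero ne = ⊥-elim (ne refl)
predF (suc j) ne = j

predF-suc : ∀ {n} (j : Fin (suc n)) (ne : j ≢ zero) → suc (predF j ne) ≡ j
predF-suc zero ne = ⊥-elim (ne refl)
predF-suc (suc j) ne = refl

-- An injection of Fin K into {u | Q u} shows that Q holds at least K
-- times; this bounds degrees from below when colours are exhausted.
count≥injection : ∀ {n K} (Q : Fin n → Bool) (g : Fin K → Fin n) → (∀ x y → g x ≡ g y → x ≡ y) →
                  (∀ x → Q (g x) ≡ true) → K ≤ ∑ (λ u → 𝟙 (Q u))
count≥injection {zero} {zero} Q g inj hq = z≤n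
count≥injection {zero} {suc K} Q g inj hq with g zero
... | ()
count≥injection {suc n} {K} Q g inj hq with FP.any? (λ x → g x FP.≟ zero)
... | no missesZero =
  ℕP.≤-trans (count≥injection (Q ∘ suc) g' inj' hq') (ℕP.m≤n+m _ (𝟙 (Q zero)))
  where
  g' : Fin K → Fin n
  g' x = predF (g x) (λ e → missesZero (x , e))
  inj' : ∀ x y → g' x ≡ g' y → x ≡ y
  inj' x y e = inj x y (trans (esym (predF-suc (g x) _)) (trans (cong suc e) (predF-suc (g y) _)))
  hq' : ∀ x → Q (suc (g' x)) ≡ true
  hq' x = trans (cong Q (predF-suc (g x) _)) (hq x)
... | yes (x0 , e0) = hitsZero K x0 g inj hq e0
  where
  -- remove x0 from the domain and vertex zero from the codomain
  hitsZero : ∀ K (x0 : Fin K) (g : Fin K → Fin (suc n)) → (∀ x y → g x ≡ g y → x ≡ y) →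
             (∀ x → Q (g x) ≡ true) → g x0 ≡ zero → K ≤ ∑ (λ u → 𝟙 (Q u))
  hitsZero (suc K') x0 g inj hq e0 = subst (λ z → suc K' ≤ 𝟙 z + ∑ (λ u → 𝟙 (Q (suc u))))
        (esym (trans (cong Q (esym e0)) (hq x0))) (s≤s (count≥injection (Q ∘ suc) g' inj' hq'))
    where
    ne : ∀ y → g (Fin.punchIn x0 y) ≢ zero
    ne y e = FP.punchInᵢ≢i x0 y (inj _ _ (trans e (esym e0)))
    g' : Fin K' → Fin n
    g' y = predF (g (Fin.punchIn x0 y)) (ne y)
    inj' : ∀ x y → g' x ≡ g' y → x ≡ y
    inj' x y e = FP.punchIn-injective x0 x y (inj _ _
      (trans (esym (predF-suc _ (ne x))) (trans (cong suc e) (predF-suc _ (ne y)))))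
    hq' : ∀ y → Q (suc (g' y)) ≡ true
    hq' y = trans (cong Q (predF-suc _ (ne y))) (hq _)

-- Greedy extension of colourings: if a proper K-colouring is known on
-- the set S and every vertex outside S has degree < K, colouring the
-- remaining vertices one by one (in order of position) never gets stuck.
module GreedyExtension {n} (a : Fin n → Fin n → Bool) (asym : ∀ u v → a u v ≡ a v u)
                       (airr : ∀ v → a v v ≡ false) where

  ProperOn : ∀ {K} → (Fin n → Fin K) → (Fin n → Set) → Set
  ProperOn c P = ∀ u v → P u → P v → a u v ≡ true → c u ≢ c v

  colouredNeighbour? : ∀ {K} (c : Fin n → Fin K) (P : Fin n → Set) (P? : ∀ u → Dec (P u)) v x u →
                       Dec ((a v u ≡ true × P u) × c u ≡ x)
  colouredNeighbour? c P P? v x u with a v u Data.Bool.≟ true | P? u | c u FP.≟ x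
  ... | yes p | yes q | yes r = yes ((p , q) , r)
  ... | no p | _ | _ = no (λ z → p (proj₁ (proj₁ z)))
  ... | yes p | no q | _ = no (λ z → q (proj₂ (proj₁ z)))
  ... | yes p | yes q | no r = no (λ z → r (proj₂ z))

  -- A vertex of degree < K sees fewer than K colours, so some colour is
  -- free: otherwise choosing a neighbour of each colour injects Fin K
  -- into its neighbourhood.
  freeColour : ∀ {K} (c : Fin n → Fin K) (P : Fin n → Set) (P? : ∀ u → Dec (P u)) v →
               degOf a v < K → ∃ λ x → ∀ u → P u → a v u ≡ true → c u ≢ x
  freeColour {K} c P P? v dv<K with FP.all? (λ x → FP.any? (λ u → colouredNeighbour? c P P? v x u))
  ... | yes allUsed = ⊥-elim (ℕP.<⇒≱ dv<K (count≥injection (a v) g g-inj g-adj))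
    where
    g : Fin K → Fin n
    g x = proj₁ (allUsed x)
    g-inj : ∀ x y → g x ≡ g y → x ≡ y
    g-inj x y e = trans (esym (proj₂ (proj₂ (allUsed x)))) (trans (cong c e) (proj₂ (proj₂ (allUsed y))))
    g-adj : ∀ x → a v (g x) ≡ true
    g-adj x = proj₁ (proj₁ (proj₂ (allUsed x)))
  ... | no notAllUsed with FP.¬∀⟶∃¬ K _ (λ x → FP.any? (λ u → colouredNeighbour? c P P? v x u)) notAllUsed
  ... | x , unused = x , λ u pu avu e → unused (u , (avu , pu) , e)

  -- vertices already coloured after processing the positions below t
  Done : (Fin n → Bool) → ℕ → Fin n → Set
  Done S t u = (S u ≡ true) ⊎ (toℕ u < t)

  Done? : ∀ S t u → Dec (Done S t u)
  Done? S t u with S u Data.Bool.≟ true | toℕ u <? t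
  ... | yes p | _ = yes (inj₁ p)
  ... | no p | yes q = yes (inj₂ q)
  ... | no p | no q = no λ { (inj₁ x) → p x ; (inj₂ y) → q y }

  extendOneVertex : ∀ {K} (S : Fin n → Bool) → (∀ v → S v ≡ false → degOf a v < K) →
                    ∀ t → t < n → (c : Fin n → Fin K) → ProperOn c (Done S t) →
                    Σ (Fin n → Fin K) λ c' → ProperOn c' (Done S (suc t))
  extendOneVertex {K} S small t t<n c proper with S (fromℕ< t<n) in eqS
  ... | true = c , λ u w pu pw → proper u w (wasDone u pu) (wasDone w pw)
    where
    wasDone : ∀ u → Done S (suc t) u → Done S t u
    wasDone u (inj₁ x) = inj₁ x
    wasDone u (inj₂ y) with ℕP.m≤n⇒m<n∨m≡n (ℕP.≤-pred y)
    ... | inj₁ lt = inj₂ lt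
    ... | inj₂ eq = inj₁ (trans (cong S (esym (trans (FP.fromℕ<-cong _ _ (esym eq) t<n (FP.toℕ<n u))
                      (FP.fromℕ<-toℕ u _)))) eqS)
  ... | false = c' , proper'
    where
    v : Fin n
    v = fromℕ< t<n
    free : ∃ λ x → ∀ u → Done S t u → a v u ≡ true → c u ≢ x
    free = freeColour c (Done S t) (Done? S t) v (small v eqS)
    x : Fin K
    x = proj₁ free
    c' : Fin n → Fin K
    c' u with u FP.≟ v
    ... | yes _ = x
    ... | no _ = c u
    wasDone : ∀ u → Done S (suc t) u → u ≢ v → Done S t u
    wasDone u (inj₁ p) ne = inj₁ p
    wasDone u (inj₂ y) ne with ℕP.m≤n⇒m<n∨m≡n (ℕP.≤-pred y)
    ... | inj₁ lt = inj₂ lt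
    ... | inj₂ eq = ⊥-elim (ne (FP.toℕ-injective (trans eq (esym (FP.toℕ-fromℕ< t<n)))))
    proper' : ProperOn c' (Done S (suc t))
    proper' u w pu pw auw with u FP.≟ v | w FP.≟ v
    ... | yes refl | yes refl = λ _ → f≢t (trans (esym (airr v)) auw)
    ... | yes refl | no nw = λ e → proj₂ free w (wasDone w pw nw) auw (esym e)
    ... | no nu | yes refl = λ e → proj₂ free u (wasDone u pu nu) (trans (asym w u) auw) e
    ... | no nu | no nw = proper u w (wasDone u pu nu) (wasDone w pw nw) auw

  extendColouring : ∀ {K} (S : Fin n → Bool) → (∀ v → S v ≡ false → degOf a v < K) →
                    (c : Fin n → Fin K) → ProperOn c (λ u → S u ≡ true) → Colorable a K
  extendColouring {K} S small c proper =
    proj₁ final , λ u w e → proj₂ final u w (inj₂ (FP.toℕ<n u)) (inj₂ (FP.toℕ<n w)) e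
    where
    upTo : ∀ t → t ≤ n → Σ (Fin n → Fin K) λ c' → ProperOn c' (Done S t)
    upTo zero _ = c , λ u w pu pw → proper u w (inS pu) (inS pw)
      where inS : ∀ {u} → Done S 0 u → S u ≡ true
            inS (inj₁ x) = x
            inS (inj₂ ())
    upTo (suc t) le = extendOneVertex S small t le (proj₁ (upTo t (ℕP.<⇒≤ le))) (proj₂ (upTo t (ℕP.<⇒≤ le)))
    final : Σ (Fin n → Fin K) λ c' → ProperOn c' (Done S n)
    final = upTo n ℕP.≤-refl

-- The 5-cycle: decision by evaluation over Fin 5

-- Finite statements about Fin 5 are checked by evaluating a Boolean test.
allB5 : (Fin 5 → Bool) → Bool
allB5 b = b 0F ∧ b 1F ∧ b 2F ∧ b 3F ∧ b 4F

∧-l : ∀ {x y} → (x ∧ y) ≡ true → x ≡ true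
∧-l {true} e = refl
∧-r : ∀ {x y} → (x ∧ y) ≡ true → y ≡ true
∧-r {true} e = e

allB5-sound : ∀ b → allB5 b ≡ true → ∀ i → b i ≡ true
allB5-sound b e 0F = ∧-l {b 0F} e
allB5-sound b e 1F = ∧-l {b 1F} (∧-r {b 0F} e)
allB5-sound b e 2F = ∧-l {b 2F} (∧-r {b 1F} (∧-r {b 0F} e))
allB5-sound b e 3F = ∧-l {b 3F} (∧-r {b 2F} (∧-r {b 1F} (∧-r {b 0F} e)))
allB5-sound b e 4F = ∧-r {b 3F} (∧-r {b 2F} (∧-r {b 1F} (∧-r {b 0F} e)))

allB5-complete : ∀ b → (∀ i → b i ≡ true) → allB5 b ≡ true
allB5-complete b h rewrite h 0F | h 1F | h 2F | h 3F | h 4F = refl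

allPairs5-sound : ∀ (b : Fin 5 → Fin 5 → Bool) → allB5 (λ i → allB5 (b i)) ≡ true → ∀ i j → b i j ≡ true
allPairs5-sound b e i = allB5-sound (b i) (allB5-sound (λ i → allB5 (b i)) e i)

-- The 3-colouring 0,1,0,1,2 of C₅ and, for each j0, its rotation giving
-- colour 2 to j0 alone.
c5ColourN : ℕ → ℕ
c5ColourN 0 = 0
c5ColourN 1 = 1
c5ColourN 2 = 0
c5ColourN 3 = 1
c5ColourN _ = 2

c5ColourN≤2 : ∀ k → c5ColourN k ≤ 2
c5ColourN≤2 0 = z≤n
c5ColourN≤2 1 = s≤s z≤n
c5ColourN≤2 2 = z≤n
c5ColourN≤2 3 = s≤s z≤n
c5ColourN≤2 (suc (suc (suc (suc k)))) = ℕP.≤-refl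

c5Colour : Fin 5 → ℕ
c5Colour j = c5ColourN (toℕ j)

c5ColourAvoid : Fin 5 → Fin 5 → ℕ
c5ColourAvoid j0 j = c5ColourN ((toℕ j + 9 ∸ toℕ j0) % 5)

properAt : (Fin 5 → ℕ) → Fin 5 → Fin 5 → Bool
properAt col i j = not (c5adj i j) ∨ not (col i ≡ᵇ col j)

properAt-sound : ∀ col i j → properAt col i j ≡ true → c5adj i j ≡ true → col i ≢ col j
properAt-sound col i j ok adj e with c5adj i j | col i ≡ᵇ col j | ℕP.≡⇒≡ᵇ (col i) (col j) e
... | true | true | _ = f≢t ok
... | true | false | ()
properAt-sound col i j ok () e | false | _ | _

c5Colour-proper : ∀ i j → c5adj i j ≡ true → c5Colour i ≢ c5Colour j
c5Colour-proper i j = properAt-sound c5Colour i j (allPairs5-sound (properAt c5Colour) refl i j)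

c5ColourAvoid-proper : ∀ j0 i j → c5adj i j ≡ true → c5ColourAvoid j0 i ≢ c5ColourAvoid j0 j
c5ColourAvoid-proper j0 i j = properAt-sound (c5ColourAvoid j0) i j
  (allPairs5-sound (properAt (c5ColourAvoid j0)) (allB5-sound (λ j0 → allB5 (λ i → allB5 (properAt (c5ColourAvoid j0) i))) refl j0) i j)

c5ColourAvoid≤2 : ∀ j0 j → c5ColourAvoid j0 j ≤ 2
c5ColourAvoid≤2 j0 j = c5ColourN≤2 _

c5ColourAvoid-2 : ∀ j0 j → c5ColourAvoid j0 j ≡ 2 → j ≡ j0
c5ColourAvoid-2 0F 0F e = refl
c5ColourAvoid-2 1F 1F e = refl
c5ColourAvoid-2 2F 2F e = refl
c5ColourAvoid-2 3F 3F e = refl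
c5ColourAvoid-2 4F 4F e = refl
c5ColourAvoid-2 0F 1F ()
c5ColourAvoid-2 0F 2F ()
c5ColourAvoid-2 0F 3F ()
c5ColourAvoid-2 0F 4F ()
c5ColourAvoid-2 1F 0F ()
c5ColourAvoid-2 1F 2F ()
c5ColourAvoid-2 1F 3F ()
c5ColourAvoid-2 1F 4F ()
c5ColourAvoid-2 2F 0F ()
c5ColourAvoid-2 2F 1F ()
c5ColourAvoid-2 2F 3F ()
c5ColourAvoid-2 2F 4F ()
c5ColourAvoid-2 3F 0F ()
c5ColourAvoid-2 3F 1F ()
c5ColourAvoid-2 3F 2F ()
c5ColourAvoid-2 3F 4F ()
c5ColourAvoid-2 4F 0F ()
c5ColourAvoid-2 4F 1F ()
c5ColourAvoid-2 4F 2F ()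
c5ColourAvoid-2 4F 3F ()
-- Lower bound: a clique joined to C₅

-- C₅ is not 2-colourable: every proper colouring shows three distinct
-- colours (on 0,1,2 unless 0 and 2 agree, and then on 2,3,4).
c5-threeColours : ∀ {K} (c : Fin 5 → Fin K) → (∀ i j → c5adj i j ≡ true → c i ≢ c j) →
                  Σ (Fin 3 → Fin 5) λ t → ∀ p q → p ≢ q → c (t p) ≢ c (t q)
c5-threeColours c proper with c 0F FP.≟ c 2F
... | no c0≢c2 = t , distinct
  where
  t : Fin 3 → Fin 5
  t 0F = 0F
  t 1F = 1F
  t 2F = 2F
  distinct : ∀ p q → p ≢ q → c (t p) ≢ c (t q)
  distinct 0F 0F d = ⊥-elim (d refl)
  distinct 0F 1F d = proper 0F 1F refl
  distinct 0F 2F d = c0≢c2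
  distinct 1F 0F d = proper 1F 0F refl
  distinct 1F 1F d = ⊥-elim (d refl)
  distinct 1F 2F d = proper 1F 2F refl
  distinct 2F 0F d = c0≢c2 ∘ esym
  distinct 2F 1F d = proper 2F 1F refl
  distinct 2F 2F d = ⊥-elim (d refl)
... | yes c0≡c2 = t , distinct
  where
  t : Fin 3 → Fin 5
  t 0F = 2F
  t 1F = 3F
  t 2F = 4F
  c2≢c4 : c 2F ≢ c 4F
  c2≢c4 e = proper 0F 4F refl (trans c0≡c2 e)
  distinct : ∀ p q → p ≢ q → c (t p) ≢ c (t q)
  distinct 0F 0F d = ⊥-elim (d refl)
  distinct 0F 1F d = proper 2F 3F refl
  distinct 0F 2F d = c2≢c4
  distinct 1F 0F d = proper 3F 2F refl
  distinct 1F 1F d = ⊥-elim (d refl)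
  distinct 1F 2F d = proper 3F 4F refl
  distinct 2F 0F d = c2≢c4 ∘ esym
  distinct 2F 1F d = proper 4F 3F refl
  distinct 2F 2F d = ⊥-elim (d refl)

-- A clique on x vertices completely joined to an induced C₅ needs at
-- least x + 3 colours: the clique and three colours of the cycle are all
-- pairwise distinct.
χ≥clique+C5 : ∀ {n x K} (a : Fin n → Fin n → Bool) (e : Fin x → Fin n) (f : Fin 5 → Fin n) →
              (∀ i i' → i ≢ i' → a (e i) (e i') ≡ true) →
              (∀ i j → a (f i) (f j) ≡ c5adj i j) →
              (∀ i j → a (e i) (f j) ≡ true) →
              (c : Fin n → Fin K) → (∀ u v → a u v ≡ true → c u ≢ c v) → x + 3 ≤ K
χ≥clique+C5 {n} {x} {K} a e f clique cycle join c proper =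
  FP.injective⇒≤ {f = g ∘ splitAt x} (λ {i} {i'} eq → splitAt-injective i i' (g-inj _ _ eq))
  where
  three : Σ (Fin 3 → Fin 5) λ t → ∀ p q → p ≢ q → c (f (t p)) ≢ c (f (t q))
  three = c5-threeColours (c ∘ f) (λ i j h → proper (f i) (f j) (trans (cycle i j) h))
  t : Fin 3 → Fin 5
  t = proj₁ three
  g : Fin x ⊎ Fin 3 → Fin K
  g (inj₁ i) = c (e i)
  g (inj₂ p) = c (f (t p))
  g-inj : ∀ s s' → g s ≡ g s' → s ≡ s'
  g-inj (inj₁ i) (inj₁ i') eq with i FP.≟ i'
  ... | yes refl = refl
  ... | no d = ⊥-elim (proper _ _ (clique i i' d) eq)
  g-inj (inj₁ i) (inj₂ p) eq = ⊥-elim (proper _ _ (join i (t p)) eq)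
  g-inj (inj₂ p) (inj₁ i) eq = ⊥-elim (proper _ _ (join i (t p)) (esym eq))
  g-inj (inj₂ p) (inj₂ q) eq with p FP.≟ q
  ... | yes refl = refl
  ... | no d = ⊥-elim (proj₂ three p q d eq)
  splitAt-injective : ∀ i i' → splitAt x {3} i ≡ splitAt x i' → i ≡ i'
  splitAt-injective i i' eq =
    trans (esym (FP.join-splitAt x 3 i)) (trans (cong (Fin.join x 3) eq) (FP.join-splitAt x 3 i'))

<⇒≤∸1 : ∀ {t w} → t < w → t ≤ w ∸ 1
<⇒≤∸1 {w = suc w} (s≤s le) = le

∸1-mono-< : ∀ {z x} → 0 < z → z < x → z ∸ 1 < x ∸ 1
∸1-mono-< {suc z} {suc x} _ (s≤s h) = h

≢∧≮⇒> : ∀ {w t0} → w ≢ t0 → ¬ (w < t0) → t0 < w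
≢∧≮⇒> {w} {t0} ne nl with ℕP.<-cmp w t0
... | tri< x _ _ = ⊥-elim (nl x)
... | tri≈ _ y _ = ⊥-elim (ne y)
... | tri> _ _ c = c

-- Close the gap left by an unused label t0: labels above t0 move down by
-- one, so x labels other than t0 fit into x ∸ 1 values, injectively.
squeeze : ℕ → ℕ → ℕ
squeeze t0 z with z <? t0
... | yes _ = z
... | no _ = z ∸ 1

squeeze-bound : ∀ t0 x z → t0 < x → z < x → z ≢ t0 → squeeze t0 z < x ∸ 1
squeeze-bound t0 x z t0<x z<x ne with z <? t0
... | yes lt = ℕP.<-≤-trans lt (<⇒≤∸1 t0<x)
... | no nlt = ∸1-mono-< (ℕP.≤-trans (s≤s z≤n) (≢∧≮⇒> ne nlt)) z<x

squeeze-injective : ∀ t0 z z' → z ≢ t0 → z' ≢ t0 → squeeze t0 z ≡ squeeze t0 z' → z ≡ z'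
squeeze-injective t0 z z' n1 n2 e with z <? t0 | z' <? t0
... | yes _ | yes _ = e
... | no a | no b = ℕP.∸-cancelʳ-≡ (ℕP.≤-trans (s≤s z≤n) (≢∧≮⇒> n1 a)) (ℕP.≤-trans (s≤s z≤n) (≢∧≮⇒> n2 b)) e
... | yes a | no b = ⊥-elim (ℕP.<-irrefl refl (ℕP.<-≤-trans (subst (_< t0) e a) (<⇒≤∸1 (≢∧≮⇒> n2 b))))
... | no a | yes b = ⊥-elim (ℕP.<-irrefl refl (ℕP.<-≤-trans (subst (_< t0) (esym e) b) (<⇒≤∸1 (≢∧≮⇒> n1 a))))

∸1+2 : ∀ {x} → 1 ≤ x → (x ∸ 1) + 2 ≡ x + 1
∸1+2 {suc x} _ = ℕP.+-suc x 1

toFin : ∀ {n K} (col : Fin n → ℕ) → (∀ v → col v < K) → Fin n → Fin K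
toFin col b v = fromℕ< (b v)

toFin-ne : ∀ {n K} (col : Fin n → ℕ) (b : ∀ v → col v < K) u w → col u ≢ col w → toFin col b u ≢ toFin col b w
toFin-ne col b u w ne e = ne (trans (esym (FP.toℕ-fromℕ< (b u))) (trans (cong toℕ e) (FP.toℕ-fromℕ< (b w))))

<-≤-ne : ∀ {p q r} → p < q → q ≤ r → p ≢ r
<-≤-ne lt le refl = ℕP.<-irrefl refl (ℕP.<-≤-trans lt le)

+cancel : ∀ x {p q} → x + p ≡ x + q → p ≡ q
+cancel x e = ℕP.+-cancelˡ-≡ x _ _ e

-- Colourings of a graph containing a set X, whose vertices carry distinct
-- labels ι v < x, and an induced 5-cycle Y = f (Fin 5), provided every
-- vertex outside S = X ∪ Y has degree < K (so the greedy extension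
-- finishes the colouring).
--   * x + 3 colours always suffice: labels on X, three more on Y.
--   * x + 2 colours suffice if two vertices of X are non-adjacent (they
--     share a label) or some vertex u0 of X misses some f j0 (u0 takes
--     colour 2 of the C₅-colouring avoiding j0).
-- These are used with X = B in G and with X = C in the complement.
module JoinColourings {n} (a : Fin n → Fin n → Bool) (asym : ∀ u v → a u v ≡ a v u) (airr : ∀ v → a v v ≡ false)
  (isX isY : Fin n → Bool)
  (ι : Fin n → ℕ) (x : ℕ) (ιb : ∀ v → isX v ≡ true → ι v < x)
  (ιi : ∀ u v → isX u ≡ true → isX v ≡ true → ι u ≡ ι v → u ≡ v)
  (f : Fin 5 → Fin n) (fa : ∀ i j → a (f i) (f j) ≡ c5adj i j)
  (yinv : ∀ v → isY v ≡ true → Fin 5) (yinvf : ∀ v h → f (yinv v h) ≡ v) where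

  open GreedyExtension a asym airr

  S : Fin n → Bool
  S v = isX v ∨ isY v

  data Part (v : Fin n) : Set where
    inX : isX v ≡ true → Part v
    inY : isX v ≡ false → isY v ≡ true → Part v
    outside : isX v ≡ false → isY v ≡ false → Part v

  part : ∀ v → Part v
  part v with isX v in ex | isY v in ey
  ... | true | _ = inX ex
  ... | false | true = inY ex ey
  ... | false | false = outside ex ey

  outside∉S : ∀ v → isX v ≡ false → isY v ≡ false → S v ≡ true → ⊥
  outside∉S v ex ey e rewrite ex | ey = f≢t e

  colourVia : ∀ {K} (col : Fin n → ℕ) → (∀ v → col v < K) →
        (∀ u w → S u ≡ true → S w ≡ true → a u w ≡ true → col u ≢ col w) →
        (∀ v → S v ≡ false → degOf a v < K) → Colorable a K
  colourVia col bounded proper dg = extendColouring S dg (toFin col bounded) (λ u w su sw auw → toFin-ne col bounded u w (proper u w su sw auw))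

  noLoop : ∀ u w → u ≡ w → a u w ≡ true → ⊥
  noLoop u .u refl e = f≢t (trans (esym (airr u)) e)

  adjInY : ∀ u w (h : isY u ≡ true) (h' : isY w ≡ true) → a u w ≡ true → c5adj (yinv u h) (yinv w h') ≡ true
  adjInY u w h h' auw = trans (esym (fa _ _)) (subst₂ (λ p q → a p q ≡ true) (esym (yinvf u h)) (esym (yinvf w h')) auw)

  colour₁ : ∀ v → Part v → ℕ
  colour₁ v (inX _) = ι v
  colour₁ v (inY _ h) = x + c5Colour (yinv v h)
  colour₁ v (outside _ _) = 0

  colour-x+3 : ∀ K → x + 3 ≤ K → (∀ v → S v ≡ false → degOf a v < K) → Colorable a K
  colour-x+3 K le dg = colourVia (λ v → colour₁ v (part v)) (λ v → bounded v (part v)) (λ u w → proper u w (part u) (part w)) dg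
    where
    bounded : ∀ v (c : Part v) → colour₁ v c < K
    bounded v (inX h) = ℕP.<-≤-trans (ιb v h) (ℕP.≤-trans (ℕP.m≤m+n x 3) le)
    bounded v (inY _ h) = ℕP.<-≤-trans (s≤s (ℕP.+-monoʳ-≤ x (c5ColourN≤2 _))) (subst (_≤ K) (ℕP.+-suc x 2) le)
    bounded v (outside _ _) = ℕP.<-≤-trans (s≤s z≤n) (subst (_≤ K) (ℕP.+-suc x 2) le)
    XY-distinct : ∀ u w (hu : isX u ≡ true) (hw : isY w ≡ true) → ι u ≢ x + c5Colour (yinv w hw)
    XY-distinct u w hu hw = <-≤-ne (ιb u hu) (ℕP.m≤m+n x _)
    proper : ∀ u w (cu : Part u) (cw : Part w) → S u ≡ true → S w ≡ true → a u w ≡ true → colour₁ u cu ≢ colour₁ w cw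
    proper u w (inX hu) (inX hw) su sw auw e = noLoop u w (ιi u w hu hw e) auw
    proper u w (inX hu) (inY _ hw) su sw auw = XY-distinct u w hu hw
    proper u w (inY _ hu) (inX hw) su sw auw e = XY-distinct w u hw hu (esym e)
    proper u w (inY _ hu) (inY _ hw) su sw auw e = c5Colour-proper _ _ (adjInY u w hu hw auw) (+cancel x e)
    proper u w (outside p q) _ su sw auw = ⊥-elim (outside∉S u p q su)
    proper u w _ (outside p q) su sw auw = ⊥-elim (outside∉S w p q sw)

  -- x + 2 colours when u0, w0 ∈ X are non-adjacent: w0 reuses the label
  -- of u0, the other labels are squeezed into x ∸ 1 values and Y uses
  -- (x ∸ 1) + (0,1,0,1,2).
  module _ (u0 w0 : Fin n) (hu0 : isX u0 ≡ true) (hw0 : isX w0 ≡ true) (ne0 : u0 ≢ w0)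
           (na0 : a u0 w0 ≡ false) where

    dropped₂ : ℕ
    dropped₂ = ι w0

    label₂ : Fin n → ℕ
    label₂ v with v FP.≟ w0
    ... | yes _ = squeeze dropped₂ (ι u0)
    ... | no _ = squeeze dropped₂ (ι v)

    ι≢dropped₂ : ∀ v → isX v ≡ true → v ≢ w0 → ι v ≢ dropped₂
    ι≢dropped₂ v h ne e = ne (ιi v w0 h hw0 e)

    label₂-bound : ∀ v → isX v ≡ true → label₂ v < x ∸ 1
    label₂-bound v h with v FP.≟ w0
    ... | yes _ = squeeze-bound dropped₂ x (ι u0) (ιb w0 hw0) (ιb u0 hu0) (ι≢dropped₂ u0 hu0 ne0)
    ... | no ne = squeeze-bound dropped₂ x (ι v) (ιb w0 hw0) (ιb v h) (ι≢dropped₂ v h ne)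

    colour₂ : ∀ v → Part v → ℕ
    colour₂ v (inX _) = label₂ v
    colour₂ v (inY _ h) = (x ∸ 1) + c5Colour (yinv v h)
    colour₂ v (outside _ _) = 0

    label₂-proper : ∀ u w → isX u ≡ true → isX w ≡ true → a u w ≡ true → label₂ u ≢ label₂ w
    label₂-proper u w hu hw auw e with u FP.≟ w0 | w FP.≟ w0
    ... | yes p | yes q = noLoop u w (trans p (esym q)) auw
    ... | yes refl | no q = f≢t (trans (esym na0) (trans (asym u0 w0) (trans (cong (a w0) v≡) auw)))
      where v≡ : u0 ≡ w
            v≡ = ιi u0 w hu0 hw (squeeze-injective dropped₂ _ _ (ι≢dropped₂ u0 hu0 ne0) (ι≢dropped₂ w hw q) e)
    ... | no p | yes refl = f≢t (trans (esym na0) (trans (cong (λ z → a z w0) v≡) auw))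
      where v≡ : u0 ≡ u
            v≡ = ιi u0 u hu0 hu (squeeze-injective dropped₂ _ _ (ι≢dropped₂ u0 hu0 ne0) (ι≢dropped₂ u hu p) (esym e))
    ... | no p | no q = noLoop u w (ιi u w hu hw (squeeze-injective dropped₂ _ _ (ι≢dropped₂ u hu p) (ι≢dropped₂ w hw q) e)) auw

    colour-x+2-nonEdgeX : ∀ K → x + 2 ≤ K → (∀ v → S v ≡ false → degOf a v < K) → Colorable a K
    colour-x+2-nonEdgeX K le dg = colourVia (λ v → colour₂ v (part v)) (λ v → bounded v (part v)) (λ u w → proper u w (part u) (part w)) dg
      where
      x∸1+2 : (x ∸ 1) + 2 < K
      x∸1+2 = subst (_< K) (esym (∸1+2 (ℕP.≤-trans (s≤s z≤n) (ιb u0 hu0))))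
                (subst (_≤ K) (cong suc (ℕP.+-comm 1 x)) (subst (_≤ K) (ℕP.+-comm x 2) le))
      bounded : ∀ v (c : Part v) → colour₂ v c < K
      bounded v (inX h) = ℕP.<-≤-trans (label₂-bound v h) (ℕP.≤-trans (ℕP.m∸n≤m x 1) (ℕP.≤-trans (ℕP.m≤m+n x 2) le))
      bounded v (inY _ h) = ℕP.≤-<-trans (ℕP.+-monoʳ-≤ (x ∸ 1) (c5ColourN≤2 _)) x∸1+2
      bounded v (outside _ _) = ℕP.≤-<-trans z≤n x∸1+2
      XY-distinct : ∀ u w (hu : isX u ≡ true) (hw : isY w ≡ true) → label₂ u ≢ (x ∸ 1) + c5Colour (yinv w hw)
      XY-distinct u w hu hw = <-≤-ne (label₂-bound u hu) (ℕP.m≤m+n (x ∸ 1) _)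
      proper : ∀ u w (cu : Part u) (cw : Part w) → S u ≡ true → S w ≡ true → a u w ≡ true → colour₂ u cu ≢ colour₂ w cw
      proper u w (inX hu) (inX hw) su sw auw = label₂-proper u w hu hw auw
      proper u w (inX hu) (inY _ hw) su sw auw = XY-distinct u w hu hw
      proper u w (inY _ hu) (inX hw) su sw auw e = XY-distinct w u hw hu (esym e)
      proper u w (inY _ hu) (inY _ hw) su sw auw e = c5Colour-proper _ _ (adjInY u w hu hw auw) (+cancel (x ∸ 1) e)
      proper u w (outside p q) _ su sw auw = ⊥-elim (outside∉S u p q su)
      proper u w _ (outside p q) su sw auw = ⊥-elim (outside∉S w p q sw)

  -- x + 2 colours when u0 ∈ X misses f j0: u0 takes the top colour
  -- x + 1, which on Y is given to f j0 only, and the other labels are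
  -- squeezed into x ∸ 1 values.
  module _ (u0 : Fin n) (hu0 : isX u0 ≡ true) (j0 : Fin 5) (na0 : a u0 (f j0) ≡ false) where

    dropped₃ : ℕ
    dropped₃ = ι u0

    label₃ : Fin n → ℕ
    label₃ v with v FP.≟ u0
    ... | yes _ = x + 1
    ... | no _ = squeeze dropped₃ (ι v)

    ι≢dropped₃ : ∀ v → isX v ≡ true → v ≢ u0 → ι v ≢ dropped₃
    ι≢dropped₃ v h ne e = ne (ιi v u0 h hu0 e)

    x≥1 : 1 ≤ x
    x≥1 = ℕP.≤-trans (s≤s z≤n) (ιb u0 hu0)

    x∸1+2≡x+1 : (x ∸ 1) + 2 ≡ x + 1
    x∸1+2≡x+1 = ∸1+2 x≥1

    colour₃ : ∀ v → Part v → ℕ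
    colour₃ v (inX _) = label₃ v
    colour₃ v (inY _ h) = (x ∸ 1) + c5ColourAvoid j0 (yinv v h)
    colour₃ v (outside _ _) = 0

    colour-x+2-nonEdgeXY : ∀ K → x + 2 ≤ K → (∀ v → S v ≡ false → degOf a v < K) → Colorable a K
    colour-x+2-nonEdgeXY K le dg = colourVia (λ v → colour₃ v (part v)) (λ v → bounded v (part v)) (λ u w → proper u w (part u) (part w)) dg
      where
      x+1<K : x + 1 < K
      x+1<K = subst (_≤ K) (cong suc (ℕP.+-comm 1 x)) (subst (_≤ K) (ℕP.+-comm x 2) le)
      bounded : ∀ v (c : Part v) → colour₃ v c < K
      bounded v (inX h) with v FP.≟ u0
      ... | yes _ = x+1<K
      ... | no ne = ℕP.<-≤-trans (squeeze-bound dropped₃ x (ι v) (ιb u0 hu0) (ιb v h) (ι≢dropped₃ v h ne))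
                      (ℕP.≤-trans (ℕP.m∸n≤m x 1) (ℕP.≤-trans (ℕP.m≤m+n x 2) le))
      bounded v (inY _ h) = ℕP.≤-<-trans (ℕP.+-monoʳ-≤ (x ∸ 1) (c5ColourAvoid≤2 j0 (yinv v h))) (subst (_< K) (esym x∸1+2≡x+1) x+1<K)
      bounded v (outside _ _) = ℕP.≤-<-trans z≤n x+1<K
      XY-distinct : ∀ u w (hu : isX u ≡ true) (hw : isY w ≡ true) → a u w ≡ true → label₃ u ≢ (x ∸ 1) + c5ColourAvoid j0 (yinv w hw)
      XY-distinct u w hu hw auw e with u FP.≟ u0
      ... | yes refl = f≢t (trans (esym na0) (trans (cong (a u0) (trans (cong f (esym jj)) (yinvf w hw))) auw))
        where jj : yinv w hw ≡ j0
              jj = c5ColourAvoid-2 j0 _ (esym (+cancel (x ∸ 1) (trans x∸1+2≡x+1 e)))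
      ... | no ne = <-≤-ne (squeeze-bound dropped₃ x (ι u) (ιb u0 hu0) (ιb u hu) (ι≢dropped₃ u hu ne)) (ℕP.m≤m+n (x ∸ 1) _) e
      label₃-proper : ∀ u w → isX u ≡ true → isX w ≡ true → a u w ≡ true → label₃ u ≢ label₃ w
      label₃-proper u w hu hw auw e with u FP.≟ u0 | w FP.≟ u0
      ... | yes p | yes q = noLoop u w (trans p (esym q)) auw
      ... | yes p | no q = <-≤-ne (squeeze-bound dropped₃ x (ι w) (ιb u0 hu0) (ιb w hw) (ι≢dropped₃ w hw q))
                              (ℕP.≤-trans (ℕP.m∸n≤m x 1) (ℕP.m≤m+n x 1)) (esym e)
      ... | no p | yes q = <-≤-ne (squeeze-bound dropped₃ x (ι u) (ιb u0 hu0) (ιb u hu) (ι≢dropped₃ u hu p))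
                              (ℕP.≤-trans (ℕP.m∸n≤m x 1) (ℕP.m≤m+n x 1)) e
      ... | no p | no q = noLoop u w (ιi u w hu hw (squeeze-injective dropped₃ _ _ (ι≢dropped₃ u hu p) (ι≢dropped₃ w hw q) e)) auw
      proper : ∀ u w (cu : Part u) (cw : Part w) → S u ≡ true → S w ≡ true → a u w ≡ true → colour₃ u cu ≢ colour₃ w cw
      proper u w (inX hu) (inX hw) su sw auw = label₃-proper u w hu hw auw
      proper u w (inX hu) (inY _ hw) su sw auw = XY-distinct u w hu hw auw
      proper u w (inY _ hu) (inX hw) su sw auw e = XY-distinct w u hw hu (trans (asym w u) auw) (esym e)
      proper u w (inY _ hu) (inY _ hw) su sw auw e = c5ColourAvoid-proper j0 _ _ (adjInY u w hu hw auw) (+cancel (x ∸ 1) e)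
      proper u w (outside p q) _ su sw auw = ⊥-elim (outside∉S u p q su)
      proper u w _ (outside p q) su sw auw = ⊥-elim (outside∉S w p q sw)

-- Sums over intervals of positions

inInterval : ℕ → ℕ → ℕ → Bool
inInterval lo L k = not (ltb k lo) ∧ ltb (k ∸ lo) L

bnd : ∀ {n} lo L → lo + L ≤ n → (s : Fin L) → lo + toℕ s < n
bnd lo L le s = ℕP.<-≤-trans (ℕP.+-monoʳ-< lo (FP.toℕ<n s)) le

∑-interval : ∀ {n} lo L (le : lo + L ≤ n) (h : Fin n → ℕ) →
             ∑ (λ v → 𝟙 (inInterval lo L (toℕ v)) * h v) ≡ ∑ {L} (λ s → h (fromℕ< (bnd lo L le s)))
∑-interval {n} zero zero le h = ∑-zero {n}
∑-interval {suc n} zero (suc L) (s≤s le) h =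
  cong₂ _+_ (ℕP.+-identityʳ (h zero)) (∑-interval {n} zero L le (h ∘ suc))
∑-interval {suc n} (suc lo) L (s≤s le) h = ∑-interval {n} lo L le (h ∘ suc)

module _ (d : ℕ → ℕ) where
  sumFromTo-prefix : ∀ t → sumFromTo d 1 t ≡ ∑ {t} (λ s → d (suc (toℕ s)))
  sumFromTo-prefix t = sum-applyUpTo t (λ k → d (1 + k)) id

  sumFromTo-suffix : ∀ t n → sumFromTo d (suc t) n ≡ ∑ {n ∸ t} (λ s → d (suc t + toℕ s))
  sumFromTo-suffix t n = sum-applyUpTo (n ∸ t) (λ k → d (suc t + k)) id

-- The degree of v is its number of
-- neighbours below plus above; summing over the vertices below t, the
-- edges counted from below to above are the same as those counted from
-- above to below (symmetry), which rewrites condition (i) row by row.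
module RowSplit {n} (a : Fin n → Fin n → Bool) (asym : ∀ u v → a u v ≡ a v u) (t : ℕ) where
  lt : Fin n → Bool
  lt v = ltb (toℕ v) t
  ge : Fin n → Bool
  ge v = not (lt v)

  rowBelow : Fin n → ℕ
  rowBelow v = ∑ (λ w → 𝟙 (lt w) * 𝟙 (a v w))
  rowAbove : Fin n → ℕ
  rowAbove v = ∑ (λ w → 𝟙 (ge w) * 𝟙 (a v w))

  split1 : ∀ b x → x ≡ 𝟙 b * x + 𝟙 (not b) * x
  split1 true x = esym (trans (ℕP.+-identityʳ _) (ℕP.+-identityʳ x))
  split1 false x = esym (ℕP.+-identityʳ x)

  dsplit : ∀ v → degOf a v ≡ rowBelow v + rowAbove v
  dsplit v = trans (∑-cong (λ w → split1 (lt w) (𝟙 (a v w)))) (∑-distrib-+ {n} (λ w → 𝟙 (lt w) * 𝟙 (a v w)) (λ w → 𝟙 (ge w) * 𝟙 (a v w)))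

  cross : ∑ (λ v → 𝟙 (lt v) * rowAbove v) ≡ ∑ (λ v → 𝟙 (ge v) * rowBelow v)
  cross = begin
    ∑ (λ v → 𝟙 (lt v) * rowAbove v)
      ≡⟨ ∑-cong (λ v → *-distribˡ-sum (𝟙 (lt v)) (λ w → 𝟙 (ge w) * 𝟙 (a v w))) ⟩
    ∑ (λ v → ∑ (λ w → 𝟙 (lt v) * (𝟙 (ge w) * 𝟙 (a v w))))
      ≡⟨ ∑-comm {n} {n} (λ v w → 𝟙 (lt v) * (𝟙 (ge w) * 𝟙 (a v w))) ⟩
    ∑ (λ w → ∑ (λ v → 𝟙 (lt v) * (𝟙 (ge w) * 𝟙 (a v w))))
      ≡⟨ ∑-cong (λ w → ∑-cong (λ v → swapFactors v w)) ⟩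
    ∑ (λ w → ∑ (λ v → 𝟙 (ge w) * (𝟙 (lt v) * 𝟙 (a w v))))
      ≡⟨ esym (∑-cong (λ w → *-distribˡ-sum (𝟙 (ge w)) (λ v → 𝟙 (lt v) * 𝟙 (a w v)))) ⟩
    ∑ (λ v → 𝟙 (ge v) * rowBelow v) ∎
    where
    open ≡-Reasoning
    swapFactors : ∀ v w → 𝟙 (lt v) * (𝟙 (ge w) * 𝟙 (a v w)) ≡ 𝟙 (ge w) * (𝟙 (lt v) * 𝟙 (a w v))
    swapFactors v w = trans (esym (ℕP.*-assoc (𝟙 (lt v)) _ _)) (trans (cong (_* 𝟙 (a v w)) (ℕP.*-comm (𝟙 (lt v)) (𝟙 (ge w))))
             (trans (ℕP.*-assoc (𝟙 (ge w)) _ _) (cong (λ z → 𝟙 (ge w) * (𝟙 (lt v) * 𝟙 z)) (asym v w))))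

  sumLt : ∑ (λ v → 𝟙 (lt v) * degOf a v) ≡ ∑ (λ v → 𝟙 (lt v) * rowBelow v) + ∑ (λ v → 𝟙 (ge v) * rowBelow v)
  sumLt = trans (∑-cong (λ v → trans (cong (𝟙 (lt v) *_) (dsplit v)) (ℕP.*-distribˡ-+ (𝟙 (lt v)) (rowBelow v) (rowAbove v))))
            (trans (∑-distrib-+ {n} (λ v → 𝟙 (lt v) * rowBelow v) (λ v → 𝟙 (lt v) * rowAbove v)) (cong (∑ (λ v → 𝟙 (lt v) * rowBelow v) +_) cross))

  sumGe : ∑ (λ v → 𝟙 (ge v) * degOf a v) ≡ ∑ (λ v → 𝟙 (ge v) * rowBelow v) + ∑ (λ v → 𝟙 (ge v) * rowAbove v)
  sumGe = trans (∑-cong (λ v → trans (cong (𝟙 (ge v) *_) (dsplit v)) (ℕP.*-distribˡ-+ (𝟙 (ge v)) (rowBelow v) (rowAbove v))))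
            (∑-distrib-+ {n} (λ v → 𝟙 (ge v) * rowBelow v) (λ v → 𝟙 (ge v) * rowAbove v))

  -- an identity "(degree sum below) + 10 = T + (degree sum above)", in
  -- terms of rows: the cross edges cancel on both sides
  conditionI-rows : ∀ T → ∑ (λ v → 𝟙 (lt v) * degOf a v) + 10 ≡ T + ∑ (λ v → 𝟙 (ge v) * degOf a v) →
           ∑ (λ v → 𝟙 (lt v) * rowBelow v) + 10 ≡ T + ∑ (λ v → 𝟙 (ge v) * rowAbove v)
  conditionI-rows T e = ℕP.+-cancelʳ-≡ X _ _ (begin
      A + 10 + X ≡⟨ ℕP.+-assoc A 10 X ⟩
      A + (10 + X) ≡⟨ cong (A +_) (ℕP.+-comm 10 X) ⟩
      A + (X + 10) ≡⟨ esym (ℕP.+-assoc A X 10) ⟩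
      A + X + 10 ≡⟨ cong (_+ 10) (esym sumLt) ⟩
      _ ≡⟨ e ⟩
      T + _ ≡⟨ cong (T +_) sumGe ⟩
      T + (X + C) ≡⟨ cong (T +_) (ℕP.+-comm X C) ⟩
      T + (C + X) ≡⟨ esym (ℕP.+-assoc T C X) ⟩
      T + C + X ∎)
    where
    open ≡-Reasoning
    A X C : ℕ
    A = ∑ (λ v → 𝟙 (lt v) * rowBelow v)
    X = ∑ (λ v → 𝟙 (ge v) * rowBelow v)
    C = ∑ (λ v → 𝟙 (ge v) * rowAbove v)

  conditionI-rows⁻ : ∀ T → ∑ (λ v → 𝟙 (lt v) * rowBelow v) + 10 ≡ T + ∑ (λ v → 𝟙 (ge v) * rowAbove v) →
           ∑ (λ v → 𝟙 (lt v) * degOf a v) + 10 ≡ T + ∑ (λ v → 𝟙 (ge v) * degOf a v)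
  conditionI-rows⁻ T e = begin
      ∑ (λ v → 𝟙 (lt v) * degOf a v) + 10 ≡⟨ cong (_+ 10) sumLt ⟩
      A + X + 10 ≡⟨ ℕP.+-assoc A X 10 ⟩
      A + (X + 10) ≡⟨ cong (A +_) (ℕP.+-comm X 10) ⟩
      A + (10 + X) ≡⟨ esym (ℕP.+-assoc A 10 X) ⟩
      A + 10 + X ≡⟨ cong (_+ X) e ⟩
      T + C + X ≡⟨ ℕP.+-assoc T C X ⟩
      T + (C + X) ≡⟨ cong (T +_) (ℕP.+-comm C X) ⟩
      T + (X + C) ≡⟨ cong (T +_) (esym sumGe) ⟩
      T + ∑ (λ v → 𝟙 (ge v) * degOf a v) ∎
    where
    open ≡-Reasoning
    A X C : ℕ
    A = ∑ (λ v → 𝟙 (lt v) * rowBelow v)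
    X = ∑ (λ v → 𝟙 (ge v) * rowBelow v)
    C = ∑ (λ v → 𝟙 (ge v) * rowAbove v)

  -- A vertex v below t has at most t - 1 neighbours below t, with
  -- equality exactly when it is adjacent to all of them.  F w counts the
  -- slot w as used (neighbour of v, or v itself).
  module _ (airr : ∀ v → a v v ≡ false) (t≤n : t ≤ n) (v : Fin n) (ltv : lt v ≡ true) where
    F : Fin n → ℕ
    F w = 𝟙 (lt w) * 𝟙 (a v w) + 𝟙 (eqb w v)

    F≤ : ∀ w → F w ≤ 𝟙 (lt w)
    F≤ w with w FP.≟ v
    ... | yes refl rewrite airr w | ltv = s≤s z≤n
    ... | no ne with lt w
    ...   | true = subst (_≤ 1) (esym (trans (ℕP.+-identityʳ _) (ℕP.+-identityʳ _))) (𝟙≤1 (a v w))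
    ...   | false = z≤n

    rowBelow-bound : rowBelow v + 1 ≤ t
    rowBelow-bound = subst₂ _≤_ (trans (∑-distrib-+ {n} (λ w → 𝟙 (lt w) * 𝟙 (a v w)) (λ w → 𝟙 (eqb w v))) (cong (rowBelow v +_) (count-equal v))) (count-below t t≤n) (∑-mono F≤)

    rowBelow-full : (∀ w → lt w ≡ true → w ≢ v → a v w ≡ true) → rowBelow v + 1 ≡ t
    rowBelow-full full = trans (cong (rowBelow v +_) (esym (count-equal v))) (trans (esym (∑-distrib-+ {n} (λ w → 𝟙 (lt w) * 𝟙 (a v w)) (λ w → 𝟙 (eqb w v))))
                     (trans (∑-cong pt) (count-below t t≤n)))
      where
      pt : ∀ w → F w ≡ 𝟙 (lt w)
      pt w with w FP.≟ v
      ... | yes refl rewrite airr w | ltv = refl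
      ... | no ne with lt w in lw
      ...   | true rewrite full w lw ne = refl
      ...   | false = refl

    rowBelow-full⁻ : rowBelow v + 1 ≡ t → ∀ w → lt w ≡ true → w ≢ v → a v w ≡ true
    rowBelow-full⁻ e w lw ne = ind1 (a v w) (trans (esym lhs) (trans (eqpt w) (cong 𝟙 lw)))
      where
      eqpt : ∀ w → F w ≡ 𝟙 (lt w)
      eqpt = ∑-≤-≡⇒≡ F≤ (trans (∑-distrib-+ {n} (λ w → 𝟙 (lt w) * 𝟙 (a v w)) (λ w → 𝟙 (eqb w v))) (trans (cong (rowBelow v +_) (count-equal v)) (trans e (esym (count-below t t≤n)))))
      lhs : F w ≡ 𝟙 (a v w)
      lhs rewrite lw | dec-false (w FP.≟ v) ne = trans (ℕP.+-identityʳ _) (ℕP.+-identityʳ _)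
      ind1 : ∀ b → 𝟙 b ≡ 1 → b ≡ true
      ind1 true _ = refl

-- The complement graph

eqb-refl : ∀ {n} (v : Fin n) → eqb v v ≡ true
eqb-refl v = dec-true (v FP.≟ v) refl

eqb-sym : ∀ {n} (u v : Fin n) → eqb u v ≡ eqb v u
eqb-sym u v with u FP.≟ v
... | yes refl = esym (eqb-refl u)
... | no ne = esym (dec-false (v FP.≟ u) (ne ∘ esym))

complAdj-sym : ∀ {n} (H : Graph n) u v → complAdj H u v ≡ complAdj H v u
complAdj-sym H u v = cong₂ (λ p q → not p ∧ not q) (eqb-sym u v) (Graph.sym H u v)

complAdj-irrefl : ∀ {n} (H : Graph n) v → complAdj H v v ≡ false
complAdj-irrefl H v rewrite eqb-refl v = refl

-- every other vertex is a neighbour of v in exactly one of G, Ḡ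
degCompl+deg+1 : ∀ {n} (H : Graph n) v → degOf (complAdj H) v + degOf (adj H) v + 1 ≡ n
degCompl+deg+1 {n} H v = begin
  degOf (complAdj H) v + degOf (adj H) v + 1
    ≡⟨ cong₂ _+_ (esym (∑-distrib-+ (λ u → 𝟙 (complAdj H v u)) (λ u → 𝟙 (adj H v u)))) (esym (count-equal v)) ⟩
  ∑ (λ u → 𝟙 (complAdj H v u) + 𝟙 (adj H v u)) + ∑ (λ u → 𝟙 (eqb u v))
    ≡⟨ esym (∑-distrib-+ (λ u → 𝟙 (complAdj H v u) + 𝟙 (adj H v u)) (λ u → 𝟙 (eqb u v))) ⟩
  ∑ (λ u → 𝟙 (complAdj H v u) + 𝟙 (adj H v u) + 𝟙 (eqb u v))
    ≡⟨ ∑-cong exactlyOne ⟩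
  ∑ {n} (λ _ → 1) ≡⟨ ∑-one {n} ⟩
  n ∎
  where
  open ≡-Reasoning
  exactlyOne : ∀ u → 𝟙 (complAdj H v u) + 𝟙 (adj H v u) + 𝟙 (eqb u v) ≡ 1
  exactlyOne u with u FP.≟ v
  ... | yes refl rewrite eqb-refl u | Graph.irrefl H u = refl
  ... | no ne rewrite dec-false (v FP.≟ u) (ne ∘ esym) with adj H v u
  ... | true = refl
  ... | false = refl

-- C₅ is self-complementary and is the only 2-regular graph on 5 vertices

sameBool : Bool → Bool → Bool
sameBool true b = b
sameBool false b = not b

sameBool-sound : ∀ x y → sameBool x y ≡ true → x ≡ y
sameBool-sound true true _ = refl
sameBool-sound false false _ = refl

eqb-sound : ∀ {n} (x y : Fin n) → eqb x y ≡ true → x ≡ y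
eqb-sound x y e with x FP.≟ y
... | yes p = p

eqb-inj : ∀ {n} (f : Fin 5 → Fin n) → (∀ i j → f i ≡ f j → i ≡ j) → ∀ i j → eqb (f i) (f j) ≡ eqb i j
eqb-inj f finj i j with i FP.≟ j
... | yes refl = eqb-refl (f i)
... | no ne = dec-false (f i FP.≟ f j) (ne ∘ finj i j)

-- j ↦ 2j (mod 5) maps C₅ onto its complement.
c5Double : Fin 5 → Fin 5
c5Double 0F = 0F
c5Double 1F = 2F
c5Double 2F = 4F
c5Double 3F = 1F
c5Double 4F = 3F

c5Double⁻¹ : Fin 5 → Fin 5
c5Double⁻¹ 0F = 0F
c5Double⁻¹ 1F = 3F
c5Double⁻¹ 2F = 1F
c5Double⁻¹ 3F = 4F
c5Double⁻¹ 4F = 2F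

c5Double-inverse : ∀ j → c5Double (c5Double⁻¹ j) ≡ j
c5Double-inverse 0F = refl
c5Double-inverse 1F = refl
c5Double-inverse 2F = refl
c5Double-inverse 3F = refl
c5Double-inverse 4F = refl

c5-selfComplementary : ∀ i j → (not (eqb (c5Double i) (c5Double j)) ∧ not (c5adj (c5Double i) (c5Double j))) ≡ c5adj i j
c5-selfComplementary i j = sameBool-sound _ _ (allPairs5-sound
  (λ i j → sameBool (not (eqb (c5Double i) (c5Double j)) ∧ not (c5adj (c5Double i) (c5Double j))) (c5adj i j)) refl i j)

-- A loopless symmetric graph on Fin 5 is determined by the 10 bits of
-- its upper triangle.
fromBits : Vec Bool 10 → Fin 5 → Fin 5 → Bool
fromBits b 0F 0F = false
fromBits b 0F 1F = lookup b 0F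
fromBits b 0F 2F = lookup b 1F
fromBits b 0F 3F = lookup b 2F
fromBits b 0F 4F = lookup b 3F
fromBits b 1F 0F = lookup b 0F
fromBits b 1F 1F = false
fromBits b 1F 2F = lookup b 4F
fromBits b 1F 3F = lookup b 5F
fromBits b 1F 4F = lookup b 6F
fromBits b 2F 0F = lookup b 1F
fromBits b 2F 1F = lookup b 4F
fromBits b 2F 2F = false
fromBits b 2F 3F = lookup b 7F
fromBits b 2F 4F = lookup b 8F
fromBits b 3F 0F = lookup b 2F
fromBits b 3F 1F = lookup b 5F
fromBits b 3F 2F = lookup b 7F
fromBits b 3F 3F = false
fromBits b 3F 4F = lookup b 9F
fromBits b 4F 0F = lookup b 3F
fromBits b 4F 1F = lookup b 6F
fromBits b 4F 2F = lookup b 8F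
fromBits b 4F 3F = lookup b 9F
fromBits b 4F 4F = false

bitsOf : (Fin 5 → Fin 5 → Bool) → Vec Bool 10
bitsOf g = g 0F 1F ∷ g 0F 2F ∷ g 0F 3F ∷ g 0F 4F ∷ g 1F 2F ∷ g 1F 3F ∷ g 1F 4F ∷ g 2F 3F ∷ g 2F 4F ∷ g 3F 4F ∷ []

fromBits-bitsOf : (g : Fin 5 → Fin 5 → Bool) → (∀ i j → g i j ≡ g j i) → (∀ i → g i i ≡ false) →
                  ∀ i j → g i j ≡ fromBits (bitsOf g) i j
fromBits-bitsOf g gs gi 0F 0F = gi 0F
fromBits-bitsOf g gs gi 0F 1F = refl
fromBits-bitsOf g gs gi 0F 2F = refl
fromBits-bitsOf g gs gi 0F 3F = refl
fromBits-bitsOf g gs gi 0F 4F = refl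
fromBits-bitsOf g gs gi 1F 0F = gs 1F 0F
fromBits-bitsOf g gs gi 1F 1F = gi 1F
fromBits-bitsOf g gs gi 1F 2F = refl
fromBits-bitsOf g gs gi 1F 3F = refl
fromBits-bitsOf g gs gi 1F 4F = refl
fromBits-bitsOf g gs gi 2F 0F = gs 2F 0F
fromBits-bitsOf g gs gi 2F 1F = gs 2F 1F
fromBits-bitsOf g gs gi 2F 2F = gi 2F
fromBits-bitsOf g gs gi 2F 3F = refl
fromBits-bitsOf g gs gi 2F 4F = refl
fromBits-bitsOf g gs gi 3F 0F = gs 3F 0F
fromBits-bitsOf g gs gi 3F 1F = gs 3F 1F
fromBits-bitsOf g gs gi 3F 2F = gs 3F 2F
fromBits-bitsOf g gs gi 3F 3F = gi 3F
fromBits-bitsOf g gs gi 3F 4F = refl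
fromBits-bitsOf g gs gi 4F 0F = gs 4F 0F
fromBits-bitsOf g gs gi 4F 1F = gs 4F 1F
fromBits-bitsOf g gs gi 4F 2F = gs 4F 2F
fromBits-bitsOf g gs gi 4F 3F = gs 4F 3F
fromBits-bitsOf g gs gi 4F 4F = gi 4F

-- A candidate isomorphism onto C₅: a permutation and its inverse.
Candidate : Set
Candidate = Vec (Fin 5) 5 × Vec (Fin 5) 5

isIsoToC5 : Vec Bool 10 → Candidate → Bool
isIsoToC5 b (p , q) = allB5 (λ i → allB5 (λ j → sameBool (fromBits b (lookup p i) (lookup p j)) (c5adj i j)))
  ∧ (allB5 (λ i → eqb (lookup q (lookup p i)) i) ∧ allB5 (λ s → eqb (lookup p (lookup q s)) s))

twoRegularBits : Vec Bool 10 → Bool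
twoRegularBits b = allB5 (λ i → ∑ (λ j → 𝟙 (fromBits b i j)) ≡ᵇ 2)

findIso : Vec Bool 10 → List Candidate → Maybe Candidate
findIso b [] = nothing
findIso b (c ∷ cs) = if isIsoToC5 b c then just c else findIso b cs

-- the 12 labelled 5-cycles, as relabellings of C₅
candidates : List Candidate
candidates = ((0F ∷ 1F ∷ 2F ∷ 3F ∷ 4F ∷ []) , (0F ∷ 1F ∷ 2F ∷ 3F ∷ 4F ∷ [])) ∷
  ((0F ∷ 1F ∷ 2F ∷ 4F ∷ 3F ∷ []) , (0F ∷ 1F ∷ 2F ∷ 4F ∷ 3F ∷ [])) ∷
  ((0F ∷ 1F ∷ 3F ∷ 2F ∷ 4F ∷ []) , (0F ∷ 1F ∷ 3F ∷ 2F ∷ 4F ∷ [])) ∷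
  ((0F ∷ 1F ∷ 3F ∷ 4F ∷ 2F ∷ []) , (0F ∷ 1F ∷ 4F ∷ 2F ∷ 3F ∷ [])) ∷
  ((0F ∷ 1F ∷ 4F ∷ 2F ∷ 3F ∷ []) , (0F ∷ 1F ∷ 3F ∷ 4F ∷ 2F ∷ [])) ∷
  ((0F ∷ 1F ∷ 4F ∷ 3F ∷ 2F ∷ []) , (0F ∷ 1F ∷ 4F ∷ 3F ∷ 2F ∷ [])) ∷
  ((0F ∷ 2F ∷ 1F ∷ 3F ∷ 4F ∷ []) , (0F ∷ 2F ∷ 1F ∷ 3F ∷ 4F ∷ [])) ∷
  ((0F ∷ 2F ∷ 1F ∷ 4F ∷ 3F ∷ []) , (0F ∷ 2F ∷ 1F ∷ 4F ∷ 3F ∷ [])) ∷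
  ((0F ∷ 2F ∷ 3F ∷ 1F ∷ 4F ∷ []) , (0F ∷ 3F ∷ 1F ∷ 2F ∷ 4F ∷ [])) ∷
  ((0F ∷ 2F ∷ 4F ∷ 1F ∷ 3F ∷ []) , (0F ∷ 3F ∷ 1F ∷ 4F ∷ 2F ∷ [])) ∷
  ((0F ∷ 3F ∷ 1F ∷ 2F ∷ 4F ∷ []) , (0F ∷ 2F ∷ 3F ∷ 1F ∷ 4F ∷ [])) ∷
  ((0F ∷ 3F ∷ 2F ∷ 1F ∷ 4F ∷ []) , (0F ∷ 3F ∷ 2F ∷ 1F ∷ 4F ∷ [])) ∷ []

recognised : Vec Bool 10 → Bool
recognised b = not (twoRegularBits b) ∨ is-just (findIso b candidates)

allBits : ∀ k → (Vec Bool k → Bool) → Bool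
allBits zero P = P []
allBits (suc k) P = allBits k (λ v → P (true ∷ v)) ∧ allBits k (λ v → P (false ∷ v))

allBits-sound : ∀ k P → allBits k P ≡ true → ∀ v → P v ≡ true
allBits-sound zero P e [] = e
allBits-sound (suc k) P e (true ∷ v) = allBits-sound k (λ v → P (true ∷ v)) (∧-l {allBits k (λ v → P (true ∷ v))} e) v
allBits-sound (suc k) P e (false ∷ v) = allBits-sound k (λ v → P (false ∷ v)) (∧-r {allBits k (λ v → P (true ∷ v))} e) v

-- checked by evaluation over all 2¹⁰ graphs
all-recognised : allBits 10 recognised ≡ true
all-recognised = refl

findIso-sound : ∀ b cs c → findIso b cs ≡ just c → isIsoToC5 b c ≡ true
findIso-sound b (c' ∷ cs) c e with isIsoToC5 b c' in ok
... | true = subst (λ z → isIsoToC5 b z ≡ true) (just-injective e) ok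
  where just-injective : ∀ {x y : Candidate} → just x ≡ just y → x ≡ y
        just-injective refl = refl
... | false = findIso-sound b cs c e

is-just⇒∃ : ∀ {A : Set} (m : Maybe A) → is-just m ≡ true → ∃ λ c → m ≡ just c
is-just⇒∃ (just x) e = x , refl

twoRegular⇒C5 : (g : Fin 5 → Fin 5 → Bool) → (∀ i j → g i j ≡ g j i) → (∀ i → g i i ≡ false) →
  (∀ i → ∑ (λ j → 𝟙 (g i j)) ≡ 2) →
  Σ (Fin 5 → Fin 5) λ π → Σ (Fin 5 → Fin 5) λ π' →
    (∀ i → π' (π i) ≡ i) × (∀ s → π (π' s) ≡ s) × (∀ i j → g (π i) (π j) ≡ c5adj i j)
twoRegular⇒C5 g gs gi twoReg = lookup p , lookup q , inv1 , inv2 , iso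
  where
  b : Vec Bool 10
  b = bitsOf g
  regular : twoRegularBits b ≡ true
  regular = allB5-complete (λ i → ∑ (λ j → 𝟙 (fromBits b i j)) ≡ᵇ 2) (λ i → subst (λ z → (z ≡ᵇ 2) ≡ true)
              (esym (trans (∑-cong (λ j → cong 𝟙 (esym (fromBits-bitsOf g gs gi i j)))) (twoReg i))) refl)
  found : ∃ λ c → findIso b candidates ≡ just c
  found = is-just⇒∃ (findIso b candidates)
            (subst (λ z → (not z ∨ is-just (findIso b candidates)) ≡ true) regular
              (allBits-sound 10 recognised all-recognised b))
  p q : Vec (Fin 5) 5
  p = proj₁ (proj₁ found)
  q = proj₂ (proj₁ found)
  ok : isIsoToC5 b (p , q) ≡ true
  ok = findIso-sound b candidates (p , q) (proj₂ found)
  isoBits : ∀ i j → sameBool (fromBits b (lookup p i) (lookup p j)) (c5adj i j) ≡ true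
  isoBits = allPairs5-sound (λ i j → sameBool (fromBits b (lookup p i) (lookup p j)) (c5adj i j)) (∧-l {allB5 (λ i → allB5 (λ j → sameBool (fromBits b (lookup p i) (lookup p j)) (c5adj i j)))} ok)
  inverses : (allB5 (λ i → eqb (lookup q (lookup p i)) i) ∧ allB5 (λ s → eqb (lookup p (lookup q s)) s)) ≡ true
  inverses = ∧-r {allB5 (λ i → allB5 (λ j → sameBool (fromBits b (lookup p i) (lookup p j)) (c5adj i j)))} ok
  inv1 : ∀ i → lookup q (lookup p i) ≡ i
  inv1 i = eqb-sound _ _ (allB5-sound (λ i → eqb (lookup q (lookup p i)) i) (∧-l {allB5 (λ i → eqb (lookup q (lookup p i)) i)} inverses) i)
  inv2 : ∀ s → lookup p (lookup q s) ≡ s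
  inv2 s = eqb-sound _ _ (allB5-sound (λ s → eqb (lookup p (lookup q s)) s) (∧-r {allB5 (λ i → eqb (lookup q (lookup p i)) i)} inverses) s)
  iso : ∀ i j → g (lookup p i) (lookup p j) ≡ c5adj i j
  iso i j = trans (fromBits-bitsOf g gs gi _ _) (sameBool-sound _ _ (isoBits i j))

module Transfer {n} (G H : Graph n) (π π' : Fin n → Fin n)
  (inv1 : ∀ i → π' (π i) ≡ i) (inv2 : ∀ u → π (π' u) ≡ u)
  (adjHG : ∀ i j → adj H i j ≡ adj G (π i) (π j))
  (sumInv : ∀ (g : Fin n → ℕ) → ∑ g ≡ ∑ (g ∘ π)) where

  degHG : ∀ i → deg H i ≡ deg G (π i)
  degHG i = trans (deg≡degOf H i) (trans (∑-cong (λ u → cong 𝟙 (adjHG i u)))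
              (trans (esym (sumInv (λ u → 𝟙 (adj G (π i) u)))) (esym (deg≡degOf G (π i)))))

  π-inj : ∀ i j → π i ≡ π j → i ≡ j
  π-inj i j e = trans (esym (inv1 i)) (trans (cong π' e) (inv1 j))

  π'-inj : ∀ i j → π' i ≡ π' j → i ≡ j
  π'-inj i j e = trans (esym (inv2 i)) (trans (cong π e) (inv2 j))

  eqbπ : ∀ i j → eqb i j ≡ eqb (π i) (π j)
  eqbπ i j with i FP.≟ j
  ... | yes refl = esym (eqb-refl (π i))
  ... | no ne = esym (dec-false (π i FP.≟ π j) (ne ∘ π-inj i j))

  cadjHG : ∀ i j → complAdj H i j ≡ complAdj G (π i) (π j)
  cadjHG i j = cong₂ (λ p q → not p ∧ not q) (eqbπ i j) (adjHG i j)

  module Col (aG aH : Fin n → Fin n → Bool) (e : ∀ i j → aH i j ≡ aG (π i) (π j)) where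
    G→H : ∀ {K} → Colorable aG K → Colorable aH K
    G→H (c , pc) = c ∘ π , λ u v h → pc (π u) (π v) (trans (esym (e u v)) h)
    H→G : ∀ {K} → Colorable aH K → Colorable aG K
    H→G (c , pc) = c ∘ π' , λ u v h → pc (π' u) (π' v)
      (trans (e (π' u) (π' v)) (trans (cong₂ aG (inv2 u) (inv2 v)) h))
    chi : ∀ {k} → IsChromaticNumber aG k → IsChromaticNumber aH k
    chi (c , m) = G→H c , λ j cj → m j (H→G cj)

  module C1 = Col (adj G) (adj H) adjHG
  module C2 = Col (complAdj G) (complAdj H) cadjHG

  ng3 : IsNG3 G → IsNG3 H
  ng3 ((k , l , ck , cl , e) , (k' , ck' , (f , finj , fiff , fadj))) =
    (k , l , C1.chi ck , C2.chi cl , e) , (k' , C1.chi ck' , (π' ∘ f , inj , iff , adjH))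
    where
    inj : ∀ {i j} → π' (f i) ≡ π' (f j) → i ≡ j
    inj e = finj (π'-inj _ _ e)
    iff : ∀ v → SetA H k' v ⇔ ∃ λ i → π' (f i) ≡ v
    iff v = mk⇔ to from
      where
      to : SetA H k' v → ∃ λ i → π' (f i) ≡ v
      to h with Equivalence.to (fiff (π v)) (trans (esym (degHG v)) h)
      ... | i , fi = i , trans (cong π' fi) (inv1 v)
      from : (∃ λ i → π' (f i) ≡ v) → SetA H k' v
      from (i , fi) = trans (degHG v) (trans (cong (deg G) (trans (cong π (esym fi)) (inv2 (f i))))
                        (Equivalence.from (fiff (f i)) (i , refl)))
    adjH : ∀ i j → adj H (π' (f i)) (π' (f j)) ≡ c5adj i j
    adjH i j = trans (adjHG _ _) (trans (cong₂ (adj G) (inv2 (f i)) (inv2 (f j))) (fadj i j))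

relabel : ∀ {n} (G : Graph n) (σ : Permutation′ n) → Graph n
relabel G σ = record { adj = λ i j → adj G (σ ⟨$⟩ʳ i) (σ ⟨$⟩ʳ j)
                     ; sym = λ i j → Graph.sym G _ _ ; irrefl = λ i → Graph.irrefl G _ }

module Relabel {n} (G : Graph n) (σ : Permutation′ n) where
  H : Graph n
  H = relabel G σ
  module T1 = Transfer G H (σ ⟨$⟩ʳ_) (σ ⟨$⟩ˡ_) (λ i → inverseˡ σ) (λ u → inverseʳ σ) (λ i j → refl) (λ g → ∑-permute g σ)
  module T2 = Transfer H G (σ ⟨$⟩ˡ_) (σ ⟨$⟩ʳ_) (λ i → inverseʳ σ) (λ u → inverseˡ σ)
    (λ i j → esym (cong₂ (adj G) (inverseʳ σ) (inverseʳ σ))) (λ g → ∑-permute g (Perm.flip σ))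

  equiv : IsNG3 G ⇔ IsNG3 H
  equiv = mk⇔ T1.ng3 T2.ng3

  degH : ∀ i → deg H i ≡ deg G (σ ⟨$⟩ʳ i)
  degH = T1.degHG

ltb-t : ∀ {k t} → ltb k t ≡ true → k < t
ltb-t {k} {t} e with k <? t
... | yes p = p
... | no p = ⊥-elim (f≢t (trans (esym (dec-false (k <? t) p)) e))

ltb-f : ∀ {k t} → ltb k t ≡ false → ¬ (k < t)
ltb-f {k} {t} e with k <? t
... | no p = p
... | yes p = ⊥-elim (f≢t (trans (esym e) (dec-true (k <? t) p)))

t-ltb : ∀ {k t} → k < t → ltb k t ≡ true
t-ltb {k} {t} p = dec-true (k <? t) p

f-ltb : ∀ {k t} → ¬ (k < t) → ltb k t ≡ false
f-ltb {k} {t} p = dec-false (k <? t) p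

not-t : ∀ {b} → not b ≡ true → b ≡ false
not-t {false} e = refl

∨-false : ∀ {x y} → (x ∨ y) ≡ false → x ≡ false × y ≡ false
∨-false {false} {false} e = refl , refl

fin→pos : ∀ {k} → Fin k → 1 ≤ k
fin→pos {suc k} _ = s≤s z≤n

k∸1<k : ∀ {k} → 1 ≤ k → k ∸ 1 < k
k∸1<k {suc k} _ = ℕP.≤-refl

suc[k∸1]≡k : ∀ {k} → 1 ≤ k → suc (k ∸ 1) ≡ k
suc[k∸1]≡k {suc k} _ = refl

p+3+2≡p+5 : ∀ p → p + 3 + 2 ≡ p + 5
p+3+2≡p+5 = solve-∀

p+3+3≡1+p+5 : ∀ p → p + 3 + 3 ≡ suc (p + 5)
p+3+3≡1+p+5 = solve-∀

p+5≡p+4+1 : ∀ p → p + 5 ≡ p + 4 + 1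
p+5≡p+4+1 = solve-∀

rowTotal : ∀ p → (p + 3 + 2) * (p + 3 + 1) ≡ p * (p + 4) + 5 * (p + 2) + 10
rowTotal = solve-∀

count-between : ∀ {n} lo t → lo ≤ t → t ≤ n →
                ∑ {n} (λ v → 𝟙 (not (ltb (toℕ v) lo)) * 𝟙 (ltb (toℕ v) t)) ≡ t ∸ lo
count-between {n} lo t lo≤t t≤n = trans (esym (ℕP.m+n∸m≡n lo X)) (cong (_∸ lo) total)
  where
  X : ℕ
  X = ∑ {n} (λ v → 𝟙 (not (ltb (toℕ v) lo)) * 𝟙 (ltb (toℕ v) t))
  split : ∀ (v : Fin n) → 𝟙 (ltb (toℕ v) t) ≡ 𝟙 (ltb (toℕ v) lo) + 𝟙 (not (ltb (toℕ v) lo)) * 𝟙 (ltb (toℕ v) t)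
  split v with toℕ v <? lo
  ... | yes q rewrite t-ltb {toℕ v} {t} (ℕP.<-≤-trans q lo≤t) | t-ltb q = refl
  ... | no q rewrite f-ltb q = esym (ℕP.+-identityʳ _)
  total : lo + X ≡ t
  total = trans (cong (_+ X) (esym (count-below lo (ℕP.≤-trans lo≤t t≤n))))
            (trans (esym (∑-distrib-+ {n} (λ v → 𝟙 (ltb (toℕ v) lo)) (λ v → 𝟙 (not (ltb (toℕ v) lo)) * 𝟙 (ltb (toℕ v) t))))
              (trans (esym (∑-cong split)) (count-below t t≤n)))

inj-int : ∀ {K} lo hi (g : Fin K → ℕ) → (∀ i → lo ≤ g i) → (∀ i → g i < hi) →
          (∀ i j → g i ≡ g j → i ≡ j) → K ≤ hi ∸ lo
inj-int {K} lo hi g glo ghi ginj = FP.injective⇒≤ {f = h} (λ {i} {j} e → ginj i j (ℕP.∸-cancelʳ-≡ (glo i) (glo j)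
   (trans (esym (FP.toℕ-fromℕ< (b i))) (trans (cong toℕ e) (FP.toℕ-fromℕ< (b j))))))
  where
  b : ∀ i → g i ∸ lo < hi ∸ lo
  b i = ℕP.∸-monoˡ-< (ghi i) (glo i)
  h : Fin K → Fin (hi ∸ lo)
  h i = fromℕ< (b i)

argmin : ∀ {k} → (Fin (suc k) → ℕ) → Fin (suc k)
argmin {zero} h = zero
argmin {suc k} h with h zero ≤? h (suc (argmin (h ∘ suc)))
... | yes _ = zero
... | no _ = suc (argmin (h ∘ suc))

argmin-minimal : ∀ {k} (h : Fin (suc k) → ℕ) j → h (argmin h) ≤ h j
argmin-minimal {zero} h zero = ℕP.≤-refl
argmin-minimal {suc k} h j with h zero ≤? h (suc (argmin (h ∘ suc)))
argmin-minimal {suc k} h zero | yes _ = ℕP.≤-refl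
argmin-minimal {suc k} h (suc j) | yes le = ℕP.≤-trans le (argmin-minimal (h ∘ suc) j)
argmin-minimal {suc k} h zero | no gt = ℕP.<⇒≤ (ℕP.≰⇒> gt)
argmin-minimal {suc k} h (suc j) | no _ = argmin-minimal (h ∘ suc) j

-- The row profile of the extremal structure at the cut p + 5: p + 4
-- neighbours below the cut for positions of B = [0, p), p + 2 for those
-- of A = [p, p + 5), nothing for C.
profile : ∀ {n} → ℕ → Fin n → ℕ
profile p v = 𝟙 (ltb (toℕ v) p) * (p + 4) + (𝟙 (not (ltb (toℕ v) p)) * 𝟙 (ltb (toℕ v) (p + 5))) * (p + 2)

profile-sum : ∀ {n} p → p + 5 ≤ n → ∑ {n} (profile p) ≡ p * (p + 4) + 5 * (p + 2)
profile-sum {n} p p+5≤n = begin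
  ∑ {n} (profile p)
    ≡⟨ ∑-distrib-+ {n} (λ v → 𝟙 (isB v) * (p + 4)) (λ v → (𝟙 (not (isB v)) * 𝟙 (isBelowCut v)) * (p + 2)) ⟩
  ∑ (λ v → 𝟙 (isB v) * (p + 4)) + ∑ (λ v → (𝟙 (not (isB v)) * 𝟙 (isBelowCut v)) * (p + 2))
    ≡⟨ cong₂ _+_ (∑-*ʳ {n} (λ v → 𝟙 (isB v)) (p + 4)) (∑-*ʳ {n} (λ v → 𝟙 (not (isB v)) * 𝟙 (isBelowCut v)) (p + 2)) ⟩
  ∑ (λ v → 𝟙 (isB v)) * (p + 4) + ∑ (λ v → 𝟙 (not (isB v)) * 𝟙 (isBelowCut v)) * (p + 2)
    ≡⟨ cong₂ (λ x y → x * (p + 4) + y * (p + 2)) (count-below p (ℕP.≤-trans (ℕP.m≤m+n p 5) p+5≤n))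
         (trans (count-between p (p + 5) (ℕP.m≤m+n p 5) p+5≤n) (ℕP.m+n∸m≡n p 5)) ⟩
  p * (p + 4) + 5 * (p + 2) ∎
  where
  open ≡-Reasoning
  isB isBelowCut : Fin n → Bool
  isB v = ltb (toℕ v) p
  isBelowCut v = ltb (toℕ v) (p + 5)

module Sorted {n} (H : Graph n) (d : ℕ → ℕ) (hd : ∀ (i : Fin n) → d (suc (toℕ i)) ≡ deg H i)
  (dmono : ∀ i j → 1 ≤ i → i ≤ j → j ≤ n → d j ≤ d i) where

  D : Fin n → ℕ
  D = deg H

  mono : ∀ (u v : Fin n) → toℕ u ≤ toℕ v → D v ≤ D u
  mono u v le = subst₂ _≤_ (hd v) (hd u) (dmono (suc (toℕ u)) (suc (toℕ v)) (s≤s z≤n) (s≤s le) (FP.toℕ<n v))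

  pos : ∀ k → k < n → Fin n
  pos k b = fromℕ< b

  tpos : ∀ k (b : k < n) → toℕ (pos k b) ≡ k
  tpos k b = FP.toℕ-fromℕ< b

  dpos : ∀ k (b : k < n) → d (suc k) ≡ D (pos k b)
  dpos k b = trans (cong (λ z → d (suc z)) (esym (tpos k b))) (hd (pos k b))

  Dd : ∀ v → D v ≡ degOf (adj H) v
  Dd v = deg≡degOf H v

  module R t = RowSplit (adj H) (Graph.sym H) t

  sumL : ∀ t → t ≤ n → sumFromTo d 1 t ≡ ∑ (λ v → 𝟙 (R.lt t v) * degOf (adj H) v)
  sumL t le = begin
    sumFromTo d 1 t ≡⟨ sumFromTo-prefix d t ⟩
    ∑ {t} (λ s → d (suc (toℕ s))) ≡⟨ ∑-cong (λ s → trans (dpos (toℕ s) (bnd 0 t le s)) (Dd _)) ⟩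
    ∑ {t} (λ s → degOf (adj H) (fromℕ< (bnd 0 t le s))) ≡⟨ esym (∑-interval 0 t le (degOf (adj H))) ⟩
    ∑ (λ v → 𝟙 (R.lt t v) * degOf (adj H) v) ∎
    where open ≡-Reasoning

  sumR : ∀ t → t ≤ n → sumFromTo d (suc t) n ≡ ∑ (λ v → 𝟙 (R.ge t v) * degOf (adj H) v)
  sumR t le = begin
    sumFromTo d (suc t) n ≡⟨ sumFromTo-suffix d t n ⟩
    ∑ {n ∸ t} (λ s → d (suc t + toℕ s)) ≡⟨ ∑-cong (λ s → trans (dpos (t + toℕ s) (bnd t (n ∸ t) le' s)) (Dd _)) ⟩
    ∑ {n ∸ t} (λ s → degOf (adj H) (fromℕ< (bnd t (n ∸ t) le' s))) ≡⟨ esym (∑-interval t (n ∸ t) le' (degOf (adj H))) ⟩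
    ∑ (λ v → 𝟙 (inInterval t (n ∸ t) (toℕ v)) * degOf (adj H) v) ≡⟨ ∑-cong (λ v → cong (λ z → 𝟙 z * degOf (adj H) v) (fromT v)) ⟩
    ∑ (λ v → 𝟙 (R.ge t v) * degOf (adj H) v) ∎
    where
    open ≡-Reasoning
    le' : t + (n ∸ t) ≤ n
    le' = ℕP.≤-reflexive (ℕP.m+[n∸m]≡n le)
    fromT : ∀ v → inInterval t (n ∸ t) (toℕ v) ≡ R.ge t v
    fromT v with toℕ v <? t
    ... | yes q rewrite t-ltb q = refl
    ... | no q rewrite f-ltb q = t-ltb (ℕP.∸-monoˡ-< (FP.toℕ<n v) (ℕP.≮⇒≥ q))

  module Plateau (p δ : ℕ) (p+5≤n : p + 5 ≤ n)
                 (plateau : ∀ v → D v ≡ δ ⇔ (p ≤ toℕ v × toℕ v < p + 5)) where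

    private
      p<n : p < n
      p<n = ℕP.<-≤-trans (ℕP.m<m+n p (s≤s z≤n)) p+5≤n
      p+4<n : p + 4 < n
      p+4<n = ℕP.<-≤-trans (ℕP.+-monoʳ-< p (s≤s (s≤s (s≤s (s≤s (s≤s z≤n)))))) p+5≤n

      first : D (pos p p<n) ≡ δ
      first = Equivalence.from (plateau _)
        (ℕP.≤-reflexive (esym (tpos p p<n)) , subst (_< p + 5) (esym (tpos p p<n)) (ℕP.m<m+n p (s≤s z≤n)))
      last : D (pos (p + 4) p+4<n) ≡ δ
      last = Equivalence.from (plateau _)
        (subst (p ≤_) (esym (tpos _ p+4<n)) (ℕP.m≤m+n p 4) ,
         subst (_< p + 5) (esym (tpos _ p+4<n)) (ℕP.+-monoʳ-< p (s≤s (s≤s (s≤s (s≤s (s≤s z≤n)))))))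

    aboveB : ∀ v → toℕ v < p → δ < D v
    aboveB v lt = ℕP.≤∧≢⇒< (subst (_≤ D v) first (mono v (pos p p<n) (subst (toℕ v ≤_) (esym (tpos p p<n)) (ℕP.<⇒≤ lt))))
                    (λ e → ℕP.<⇒≱ lt (proj₁ (Equivalence.to (plateau v) (esym e))))

    belowC : ∀ v → p + 5 ≤ toℕ v → D v < δ
    belowC v ge = ℕP.≤∧≢⇒< (subst (D v ≤_) last (mono (pos (p + 4) p+4<n) v (subst (_≤ toℕ v) (esym (tpos _ p+4<n))
                    (ℕP.≤-trans (ℕP.+-monoʳ-≤ p (s≤s (s≤s (s≤s (s≤s z≤n))))) ge))))
                    (λ e → ℕP.<⇒≱ (proj₂ (Equivalence.to (plateau v) e)) ge)

  conditionII⇔plateau : ∀ p → ConditionII n d (p + 3) ⇔ (∀ v → D v ≡ p + 2 ⇔ (p ≤ toℕ v × toℕ v < p + 5))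
  conditionII⇔plateau p = mk⇔ toPlateau fromPlateau
    where
    p+3≡p+2+1 : ∀ p → p + 3 ≡ p + 2 + 1
    p+3≡p+2+1 = solve-∀
    shift : ∀ i → suc i + 2 ≡ i + 3
    shift = solve-∀
    toPlateau : ConditionII n d (p + 3) → ∀ v → D v ≡ p + 2 ⇔ (p ≤ toℕ v × toℕ v < p + 5)
    toPlateau cII v = mk⇔ inside plateauDegree
      where
      cIIv : d (suc (toℕ v)) + 1 ≡ p + 3 ⇔ (p + 3 ≤ suc (toℕ v) + 2 × suc (toℕ v) ≤ p + 3 + 2)
      cIIv = cII (suc (toℕ v)) (s≤s z≤n) (FP.toℕ<n v)
      inside : D v ≡ p + 2 → p ≤ toℕ v × toℕ v < p + 5
      inside e with Equivalence.to cIIv (trans (cong (_+ 1) (trans (hd v) e)) (esym (p+3≡p+2+1 p)))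
      ... | lo , hi = ℕP.+-cancelʳ-≤ 3 p (toℕ v) (subst (p + 3 ≤_) (shift (toℕ v)) lo) , subst (suc (toℕ v) ≤_) (p+3+2≡p+5 p) hi
      plateauDegree : p ≤ toℕ v × toℕ v < p + 5 → D v ≡ p + 2
      plateauDegree (a , b) = ℕP.+-cancelʳ-≡ 1 (D v) (p + 2) (trans (cong (_+ 1) (esym (hd v)))
        (trans (Equivalence.from cIIv
          (subst (p + 3 ≤_) (esym (shift (toℕ v))) (ℕP.+-monoˡ-≤ 3 a) , subst (suc (toℕ v) ≤_) (esym (p+3+2≡p+5 p)) b)) (p+3≡p+2+1 p)))
    fromPlateau : (∀ v → D v ≡ p + 2 ⇔ (p ≤ toℕ v × toℕ v < p + 5)) → ConditionII n d (p + 3)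
    fromPlateau plateau zero () le
    fromPlateau plateau (suc i) _ le = mk⇔ inside plateauDegree
      where
      w : Fin n
      w = pos i le
      inside : d (suc i) + 1 ≡ p + 3 → (p + 3 ≤ suc i + 2 × suc i ≤ p + 3 + 2)
      inside e = subst (p + 3 ≤_) (esym (shift i)) (ℕP.+-monoˡ-≤ 3 (subst (p ≤_) (tpos i le) (proj₁ A)))
               , subst (suc i ≤_) (esym (p+3+2≡p+5 p)) (subst (_< p + 5) (tpos i le) (proj₂ A))
        where
        A : p ≤ toℕ w × toℕ w < p + 5
        A = Equivalence.to (plateau w)
              (ℕP.+-cancelʳ-≡ 1 (D w) (p + 2) (trans (cong (_+ 1) (esym (dpos i le))) (trans e (p+3≡p+2+1 p))))
      plateauDegree : (p + 3 ≤ suc i + 2 × suc i ≤ p + 3 + 2) → d (suc i) + 1 ≡ p + 3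
      plateauDegree (lo , hi) = trans (cong (_+ 1) (trans (dpos i le) (Equivalence.from (plateau w)
          (subst (p ≤_) (esym (tpos i le)) (ℕP.+-cancelʳ-≤ 3 p i (subst (p + 3 ≤_) (shift i) lo)) ,
           subst (_< p + 5) (esym (tpos i le)) (subst (suc i ≤_) (p+3+2≡p+5 p) hi)))))
        (esym (p+3≡p+2+1 p))

  module _ (p : ℕ) (p+5≤n : p + 5 ≤ n) where
    open RowSplit (adj H) (Graph.sym H) (p + 5)

    RowsI : Set
    RowsI = ∑ (λ v → 𝟙 (lt v) * rowBelow v) + 10 ≡ (p + 3 + 2) * (p + 3 + 1) + ∑ (λ v → 𝟙 (ge v) * rowAbove v)

    conditionI⇔rows : ConditionI n d (p + 3) ⇔ RowsI
    conditionI⇔rows = mk⇔ (λ cI → conditionI-rows _ (subst₂ (λ x y → x + 10 ≡ _ + y) below above (proj₂ cI)))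
                          (λ r → bound , subst₂ (λ x y → x + 10 ≡ _ + y) (esym below) (esym above) (conditionI-rows⁻ _ r))
      where
      bound : p + 3 + 2 ≤ n
      bound = subst (_≤ n) (esym (p+3+2≡p+5 p)) p+5≤n
      below : sumFromTo d 1 (p + 3 + 2) ≡ ∑ (λ v → 𝟙 (lt v) * degOf (adj H) v)
      below = trans (cong (sumFromTo d 1) (p+3+2≡p+5 p)) (sumL (p + 5) p+5≤n)
      above : sumFromTo d (p + 3 + 3) n ≡ ∑ (λ v → 𝟙 (ge v) * degOf (adj H) v)
      above = trans (cong (λ z → sumFromTo d z n) (p+3+3≡1+p+5 p)) (sumR (p + 5) p+5≤n)

complementDegree< : ∀ c D k l n → c + D + 1 ≡ n → k + l ≡ n + 1 → k ≤ D → c < l ∸ 1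
complementDegree< c D k l n cD k+l kD = c<l∸1 l c+2≤l
  where
  rearrange : ∀ c k → k + (c + 2) ≡ (c + k + 1) + 1
  rearrange = solve-∀
  c+2≤l : c + 2 ≤ l
  c+2≤l = ℕP.+-cancelˡ-≤ k _ _ (subst₂ _≤_ (esym (rearrange c k)) (trans (cong (_+ 1) cD) (esym k+l))
            (ℕP.+-monoˡ-≤ 1 (ℕP.+-monoˡ-≤ 1 (ℕP.+-monoʳ-≤ c kD))))
  c<l∸1 : ∀ l → c + 2 ≤ l → c < l ∸ 1
  c<l∸1 zero le = ⊥-elim (ℕP.<⇒≱ (s≤s z≤n) (ℕP.≤-trans (ℕP.m≤n+m 2 c) le))
  c<l∸1 (suc l) le = subst (_≤ l) (ℕP.+-comm c 1) (ℕP.≤-pred (subst (_≤ suc l) (ℕP.+-suc c 1) le))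

-- The layout shared by both directions: a graph H whose positions
-- [p, p + 5) are exactly the image of an induced 5-cycle f.  B = positions
-- below p, A = [p, p + 5), C = positions from p + 5 on (N of them).  The
-- colourings of JoinColourings apply with X = B, Y = A in H, and with
-- X = C, Y = A in the complement (A is a 5-cycle there too, via
-- c5Double).
module Layout {n} (H : Graph n) (p : ℕ) (p+5≤n : p + 5 ≤ n)
  (f : Fin 5 → Fin n) (finj : ∀ i j → f i ≡ f j → i ≡ j)
  (fadj : ∀ i j → adj H (f i) (f j) ≡ c5adj i j)
  (inA : ∀ v → p ≤ toℕ v → toℕ v < p + 5 → ∃ λ j → f j ≡ v) where

  isB : Fin n → Bool
  isB v = ltb (toℕ v) p
  isA : Fin n → Bool
  isA v = not (ltb (toℕ v) p) ∧ ltb (toℕ v) (p + 5)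
  isC : Fin n → Bool
  isC v = not (ltb (toℕ v) (p + 5))

  A-l : ∀ v → isA v ≡ true → p ≤ toℕ v
  A-l v h = ℕP.≮⇒≥ (ltb-f (not-t (∧-l {not (ltb (toℕ v) p)} h)))
  A-r : ∀ v → isA v ≡ true → toℕ v < p + 5
  A-r v h = ltb-t (∧-r {not (ltb (toℕ v) p)} h)

  C-ge : ∀ v → isC v ≡ true → p + 5 ≤ toℕ v
  C-ge v h = ℕP.≮⇒≥ (ltb-f (not-t h))

  yinv : ∀ v → isA v ≡ true → Fin 5
  yinv v h = proj₁ (inA v (A-l v h) (A-r v h))
  yinvf : ∀ v h → f (yinv v h) ≡ v
  yinvf v h = proj₂ (inA v (A-l v h) (A-r v h))

  N : ℕ
  N = n ∸ (p + 5)

  n≡p+5+N : n ≡ p + 5 + N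
  n≡p+5+N = esym (ℕP.m+[n∸m]≡n p+5≤n)

  ιC : Fin n → ℕ
  ιC v = toℕ v ∸ (p + 5)

  f' : Fin 5 → Fin n
  f' = f ∘ c5Double

  fa' : ∀ i j → complAdj H (f' i) (f' j) ≡ c5adj i j
  fa' i j = trans (cong₂ (λ x y → not x ∧ not y) (eqb-inj f finj (c5Double i) (c5Double j)) (fadj (c5Double i) (c5Double j)))
                  (c5-selfComplementary i j)

  module GG = JoinColourings (adj H) (Graph.sym H) (Graph.irrefl H) isB isA toℕ p
    (λ v h → ltb-t h) (λ u v _ _ e → FP.toℕ-injective e) f fadj yinv yinvf

  module GC = JoinColourings (complAdj H) (complAdj-sym H) (complAdj-irrefl H) isC isA ιC N
    (λ v h → ℕP.∸-monoˡ-< (FP.toℕ<n v) (C-ge v h))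
    (λ u v hu hv e → FP.toℕ-injective (ℕP.∸-cancelʳ-≡ (C-ge u hu) (C-ge v hv) e))
    f' fa' (λ v h → c5Double⁻¹ (yinv v h)) (λ v h → trans (cong f (c5Double-inverse (yinv v h))) (yinvf v h))

  outsideGG : ∀ v → GG.S v ≡ false → p + 5 ≤ toℕ v
  outsideGG v e with ∨-false {isB v} e
  ... | notB , notA = ℕP.≮⇒≥ (ltb-f (subst (λ z → (not z ∧ ltb (toℕ v) (p + 5)) ≡ false) notB notA))

  outsideGC : ∀ v → GC.S v ≡ false → toℕ v < p
  outsideGC v e with ∨-false {isC v} e
  ... | notC , notA = ltb-t (inB (ltb (toℕ v) p) (ltb (toℕ v) (p + 5)) (not-f notC) notA)
    where
    not-f : ∀ {b} → not b ≡ false → b ≡ true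
    not-f {true} _ = refl
    inB : ∀ x y → y ≡ true → (not x ∧ y) ≡ false → x ≡ true
    inB true y _ _ = refl
    inB false .true refl ()

  smallOutsideGG : ∀ {K} → (∀ v → p + 5 ≤ toℕ v → deg H v < K) → ∀ v → GG.S v ≡ false → degOf (adj H) v < K
  smallOutsideGG {K} small v e = subst (_< K) (deg≡degOf H v) (small v (outsideGG v e))

  smallOutsideGC : ∀ {k l} → k + l ≡ n + 1 → (∀ v → toℕ v < p → k ≤ deg H v) →
                   ∀ v → GC.S v ≡ false → degOf (complAdj H) v < l ∸ 1
  smallOutsideGC {k} {l} k+l big v e =
    complementDegree< (degOf (complAdj H) v) (deg H v) k l n
      (trans (cong (λ z → degOf (complAdj H) v + z + 1) (deg≡degOf H v)) (degCompl+deg+1 H v)) k+l (big v (outsideGC v e))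

  module RR = RowSplit (adj H) (Graph.sym H) (p + 5)

module Forward {n} (H : Graph n) (d : ℕ → ℕ) (hd : ∀ (i : Fin n) → d (suc (toℕ i)) ≡ deg H i)
  (dmono : ∀ i j → 1 ≤ i → i ≤ j → j ≤ n → d j ≤ d i)
  (k l : ℕ) (χk : IsChromaticNumber (adj H) k) (χl : IsChromaticNumber (complAdj H) l) (kl : k + l ≡ n + 1)
  (f : Fin 5 → Fin n) (finj : ∀ i j → f i ≡ f j → i ≡ j) (fiff : ∀ v → (deg H v ≡ k ∸ 1) ⇔ ∃ λ i → f i ≡ v)
  (fadj : ∀ i j → adj H (f i) (f j) ≡ c5adj i j)
  (jm : Fin 5) (p≤ : ∀ j → toℕ (f jm) ≤ toℕ (f j)) where

  open Sorted H d hd dmono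

  fA : ∀ j → D (f j) ≡ k ∸ 1
  fA j = Equivalence.from (fiff (f j)) (j , refl)

  toA : ∀ v → D v ≡ k ∸ 1 → ∃ λ j → f j ≡ v
  toA v = Equivalence.to (fiff v)

  p : ℕ
  p = toℕ (f jm)

  tf-inj : ∀ i j → toℕ (f i) ≡ toℕ (f j) → i ≡ j
  tf-inj i j e = finj i j (FP.toℕ-injective e)

  -- the five positions of A all lie in [p, n)
  p+5≤n : p + 5 ≤ n
  p+5≤n = subst (p + 5 ≤_) (ℕP.m+[n∸m]≡n (ℕP.<⇒≤ (FP.toℕ<n (f jm))))
            (ℕP.+-monoʳ-≤ p (inj-int p n (toℕ ∘ f) p≤ (λ j → FP.toℕ<n (f j)) tf-inj))

  -- A lies in [p, p + 5): otherwise the six positions p, …, p + 5 all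
  -- have degree k - 1 (degrees are sorted), but only five vertices do.
  Aint⇒ : ∀ v → D v ≡ k ∸ 1 → p ≤ toℕ v × toℕ v < p + 5
  Aint⇒ v e with toA v e
  ... | j , refl = p≤ j , lt
    where
    lt : toℕ (f j) < p + 5
    lt with toℕ (f j) <? p + 5
    ... | yes q = q
    ... | no q = ⊥-elim (ℕP.<-irrefl refl (FP.injective⇒≤ {f = g} (λ {a} {b} → ginj a b)))
      where
      ge : p + 5 ≤ toℕ (f j)
      ge = ℕP.≮⇒≥ q
      bd : ∀ (t : Fin 6) → p + toℕ t < n
      bd t = ℕP.≤-<-trans (ℕP.≤-trans (ℕP.+-monoʳ-≤ p (ℕP.≤-pred (FP.toℕ<n t))) ge) (FP.toℕ<n (f j))
      w : Fin 6 → Fin n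
      w t = pos (p + toℕ t) (bd t)
      Dw : ∀ t → D (w t) ≡ k ∸ 1
      Dw t = ℕP.≤-antisym (subst (D (w t) ≤_) (fA jm) (mono (f jm) (w t) (subst (p ≤_) (esym (tpos _ (bd t))) (ℕP.m≤m+n p _))))
               (subst (_≤ D (w t)) (fA j) (mono (w t) (f j) (subst (_≤ toℕ (f j)) (esym (tpos _ (bd t)))
                 (ℕP.≤-trans (ℕP.+-monoʳ-≤ p (ℕP.≤-pred (FP.toℕ<n t))) ge))))
      g : Fin 6 → Fin 5
      g t = proj₁ (toA (w t) (Dw t))
      ginj : ∀ a b → g a ≡ g b → a ≡ b
      ginj a b e = FP.toℕ-injective (ℕP.+-cancelˡ-≡ p _ _
        (trans (esym (tpos _ (bd a))) (trans (cong toℕ (trans (esym (proj₂ (toA (w a) (Dw a))))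
          (trans (cong f e) (proj₂ (toA (w b) (Dw b)))))) (tpos _ (bd b)))))

  -- every position of [p, p + 5) is in A: otherwise all five vertices of A
  -- would lie strictly between p and it
  Aint⇐ : ∀ v → p ≤ toℕ v → toℕ v < p + 5 → D v ≡ k ∸ 1
  Aint⇐ v pv vp with D v ℕP.≟ k ∸ 1
  ... | yes e = e
  ... | no ne = ⊥-elim (ℕP.<⇒≱ (subst (toℕ v ∸ p <_) (ℕP.m+n∸m≡n p 5) (ℕP.∸-monoˡ-< vp pv)) five)
    where
    Dlt : D v < k ∸ 1
    Dlt = ℕP.≤∧≢⇒< (subst (D v ≤_) (fA jm) (mono (f jm) v pv)) ne
    below : ∀ j → toℕ (f j) < toℕ v
    below j with toℕ (f j) <? toℕ v
    ... | yes q = q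
    ... | no q = ⊥-elim (ℕP.<-irrefl (fA j) (ℕP.≤-<-trans (mono v (f j) (ℕP.≮⇒≥ q)) Dlt))
    five : 5 ≤ toℕ v ∸ p
    five = inj-int p (toℕ v) (toℕ ∘ f) p≤ below tf-inj

  plateau : ∀ v → D v ≡ k ∸ 1 ⇔ (p ≤ toℕ v × toℕ v < p + 5)
  plateau v = mk⇔ (Aint⇒ v) (λ { (a , b) → Aint⇐ v a b })

  inA : ∀ v → p ≤ toℕ v → toℕ v < p + 5 → ∃ λ j → f j ≡ v
  inA v a b = toA v (Aint⇐ v a b)

  open Plateau p (k ∸ 1) p+5≤n plateau
  open Layout H p p+5≤n f finj fadj inA

  k≥1 : 1 ≤ k
  k≥1 = fin→pos (proj₁ (proj₁ χk) (f jm))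

  l≥1 : 1 ≤ l
  l≥1 = fin→pos (proj₁ (proj₁ χl) (f jm))

  noColG : Colorable (adj H) (k ∸ 1) → ⊥
  noColG c = ℕP.<⇒≱ (k∸1<k k≥1) (proj₂ χk (k ∸ 1) c)

  noColC : Colorable (complAdj H) (l ∸ 1) → ⊥
  noColC c = ℕP.<⇒≱ (k∸1<k l≥1) (proj₂ χl (l ∸ 1) c)

  smallG : ∀ v → GG.S v ≡ false → degOf (adj H) v < k ∸ 1
  smallG = smallOutsideGG belowC

  smallC : ∀ v → GC.S v ≡ false → degOf (complAdj H) v < l ∸ 1
  smallC = smallOutsideGC kl (λ v lt → subst (_≤ D v) (suc[k∸1]≡k k≥1) (aboveB v lt))

  -- χ(H) ≤ p + 3 and χ(H̄) ≤ N + 3 (else k - 1, l - 1 colours would do)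
  k≤ : k ≤ p + 3
  k≤ with k ≤? p + 3
  ... | yes q = q
  ... | no q = ⊥-elim (noColG (GG.colour-x+3 (k ∸ 1)
                 (ℕP.≤-pred (subst (suc (p + 3) ≤_) (esym (suc[k∸1]≡k k≥1)) (ℕP.≰⇒> q))) smallG))

  l≤ : l ≤ N + 3
  l≤ with l ≤? N + 3
  ... | yes q = q
  ... | no q = ⊥-elim (noColC (GC.colour-x+3 (l ∸ 1)
                 (ℕP.≤-pred (subst (suc (N + 3) ≤_) (esym (suc[k∸1]≡k l≥1)) (ℕP.≰⇒> q))) smallC))

  -- as k + l = n + 1 = (p + 3) + (N + 3), both bounds are equalities
  k≡ : k ≡ p + 3
  k≡ = ℕP.≤-antisym k≤ (ℕP.+-cancelʳ-≤ (N + 3) (p + 3) k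
         (subst (_≤ k + (N + 3)) (trans kl (trans (cong (_+ 1) n≡p+5+N) (rearrange p N))) (ℕP.+-monoʳ-≤ k l≤)))
    where rearrange : ∀ p N → (p + 5 + N) + 1 ≡ p + 3 + (N + 3)
          rearrange = solve-∀

  l≡ : l ≡ N + 3
  l≡ = ℕP.+-cancelˡ-≡ (p + 3) l (N + 3) (trans (cong (_+ l) (esym k≡)) (trans kl (trans (cong (_+ 1) n≡p+5+N) (rearrange p N))))
    where rearrange : ∀ p N → p + 5 + N + 1 ≡ p + 3 + (N + 3)
          rearrange = solve-∀

  k∸1≡ : k ∸ 1 ≡ p + 2
  k∸1≡ = trans (cong (_∸ 1) k≡) (cong (_∸ 1) (ℕP.+-suc p 2))

  l∸1≡ : l ∸ 1 ≡ N + 2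
  l∸1≡ = trans (cong (_∸ 1) l≡) (cong (_∸ 1) (ℕP.+-suc N 2))

  leG : p + 2 ≤ k ∸ 1
  leG = ℕP.≤-reflexive (esym k∸1≡)
  leC : N + 2 ≤ l ∸ 1
  leC = ℕP.≤-reflexive (esym l∸1≡)

  -- The (p + 2)-colourings would beat χ(H) = p + 3, and dually in the
  -- complement: B is a clique joined to A, C is independent with no
  -- neighbour in A.
  Bcl : ∀ u w → toℕ u < p → toℕ w < p → u ≢ w → adj H u w ≡ true
  Bcl u w hu hw ne with adj H u w in e
  ... | true = refl
  ... | false = ⊥-elim (noColG (GG.colour-x+2-nonEdgeX u w (t-ltb hu) (t-ltb hw) ne e (k ∸ 1) leG smallG))

  BA : ∀ u j → toℕ u < p → adj H u (f j) ≡ true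
  BA u j hu with adj H u (f j) in e
  ... | true = refl
  ... | false = ⊥-elim (noColG (GG.colour-x+2-nonEdgeXY u (t-ltb hu) j e (k ∸ 1) leG smallG))

  isC-from : ∀ {x} → p + 5 ≤ x → not (ltb x (p + 5)) ≡ true
  isC-from le rewrite f-ltb (ℕP.≤⇒≯ le) = refl

  Cind : ∀ u w → p + 5 ≤ toℕ u → p + 5 ≤ toℕ w → u ≢ w → adj H u w ≡ false
  Cind u w hu hw ne with complAdj H u w in e
  ... | true = not-t (∧-r {not (eqb u w)} e)
  ... | false = ⊥-elim (noColC (GC.colour-x+2-nonEdgeX u w (isC-from hu) (isC-from hw) ne e (l ∸ 1) leC smallC))

  AC : ∀ u j → p + 5 ≤ toℕ u → adj H u (f j) ≡ false
  AC u j hu with complAdj H u (f' (c5Double⁻¹ j)) in e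
  ... | true = subst (λ z → adj H u (f z) ≡ false) (c5Double-inverse j) (not-t (∧-r {not (eqb u (f' (c5Double⁻¹ j)))} e))
  ... | false = ⊥-elim (noColC (GC.colour-x+2-nonEdgeXY u (isC-from hu) (c5Double⁻¹ j) e (l ∸ 1) leC smallC))

  rowAbove≡0 : ∀ v → (∀ w → p + 5 ≤ toℕ w → adj H v w ≡ false) → RR.rowAbove v ≡ 0
  rowAbove≡0 v h = trans (∑-cong noneAbove) (∑-zero {n})
    where noneAbove : ∀ w → 𝟙 (RR.ge w) * 𝟙 (adj H v w) ≡ 0
          noneAbove w with toℕ w <? p + 5
          ... | yes q rewrite t-ltb q = refl
          ... | no q rewrite f-ltb q | h w (ℕP.≮⇒≥ q) = refl

  rowAbove-C : ∀ v → p + 5 ≤ toℕ v → RR.rowAbove v ≡ 0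
  rowAbove-C v hv = rowAbove≡0 v λ w hw → nonAdj w hw
    where nonAdj : ∀ w → p + 5 ≤ toℕ w → adj H v w ≡ false
          nonAdj w hw with v FP.≟ w
          ... | yes refl = Graph.irrefl H v
          ... | no ne = Cind v w hv hw ne

  rowAbove-A : ∀ j → RR.rowAbove (f j) ≡ 0
  rowAbove-A j = rowAbove≡0 (f j) λ w hw → trans (Graph.sym H (f j) w) (AC w j hw)

  rowBelow-B : ∀ v → toℕ v < p → RR.rowBelow v ≡ p + 4
  rowBelow-B v hv = ℕP.+-cancelʳ-≡ 1 (RR.rowBelow v) (p + 4) (trans
      (RR.rowBelow-full (Graph.irrefl H) p+5≤n v (t-ltb (ℕP.<-≤-trans hv (ℕP.m≤m+n p 5))) full) (p+5≡p+4+1 p))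
    where
    full : ∀ w → RR.lt w ≡ true → w ≢ v → adj H v w ≡ true
    full w lw ne with toℕ w <? p
    ... | yes q = Bcl v w hv q (ne ∘ esym)
    ... | no q with inA w (ℕP.≮⇒≥ q) (ltb-t lw)
    ...   | j , refl = BA v j hv

  rowBelow-A : ∀ v → p ≤ toℕ v → toℕ v < p + 5 → RR.rowBelow v ≡ p + 2
  rowBelow-A v a b with inA v a b
  ... | j , refl = trans (esym (ℕP.+-identityʳ _)) (trans (cong (RR.rowBelow (f j) +_) (esym (rowAbove-A j)))
                     (trans (esym (RR.dsplit (f j))) (trans (esym (Dd (f j))) (trans (fA j) k∸1≡))))

  rowsBelow≡profile : ∀ v → 𝟙 (RR.lt v) * RR.rowBelow v ≡ profile p v
  rowsBelow≡profile v with toℕ v <? p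
  ... | yes q rewrite t-ltb q | t-ltb {toℕ v} {p + 5} (ℕP.<-≤-trans q (ℕP.m≤m+n p 5)) | rowBelow-B v q = esym (ℕP.+-identityʳ _)
  ... | no q with toℕ v <? p + 5
  ...   | yes r rewrite f-ltb q | t-ltb r | rowBelow-A v (ℕP.≮⇒≥ q) r = refl
  ...   | no r rewrite f-ltb q | f-ltb r = refl

  rowsAbove≡0 : ∑ (λ v → 𝟙 (RR.ge v) * RR.rowAbove v) ≡ 0
  rowsAbove≡0 = trans (∑-cong onlyC) (∑-zero {n})
    where onlyC : ∀ v → 𝟙 (RR.ge v) * RR.rowAbove v ≡ 0
          onlyC v with toℕ v <? p + 5
          ... | yes q rewrite t-ltb q = refl
          ... | no q rewrite f-ltb q | rowAbove-C v (ℕP.≮⇒≥ q) = refl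

  rows : RowsI p p+5≤n
  rows = begin
    ∑ (λ v → 𝟙 (RR.lt v) * RR.rowBelow v) + 10 ≡⟨ cong (_+ 10) (trans (∑-cong rowsBelow≡profile) (profile-sum p p+5≤n)) ⟩
    p * (p + 4) + 5 * (p + 2) + 10              ≡⟨ esym (rowTotal p) ⟩
    (p + 3 + 2) * (p + 3 + 1)                    ≡⟨ esym (ℕP.+-identityʳ _) ⟩
    (p + 3 + 2) * (p + 3 + 1) + 0                ≡⟨ cong ((p + 3 + 2) * (p + 3 + 1) +_) (esym rowsAbove≡0) ⟩
    (p + 3 + 2) * (p + 3 + 1) + ∑ (λ v → 𝟙 (RR.ge v) * RR.rowAbove v) ∎
    where open ≡-Reasoning

  -- m = p + 3: position p + 3 = k satisfies d k = k - 1, and beyond it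
  -- d i ≤ p + 2 < i - 1
  module MaxIndex (m : ℕ) (mx : IsMaxIndex n d m) where
    k≤n : k ≤ n
    k≤n = subst (_≤ n) (esym k≡) (ℕP.≤-trans (ℕP.+-monoʳ-≤ p (s≤s (s≤s (s≤s z≤n)))) p+5≤n)

    p+2<n : p + 2 < n
    p+2<n = ℕP.<-≤-trans (ℕP.+-monoʳ-< p (s≤s (s≤s (s≤s z≤n)))) p+5≤n

    dk : d k ≡ k ∸ 1
    dk = trans (cong d (trans k≡ (ℕP.+-suc p 2))) (trans (dpos (p + 2) p+2<n)
           (Aint⇐ _ (subst (p ≤_) (esym (tpos _ p+2<n)) (ℕP.m≤m+n p 2))
                    (subst (_< p + 5) (esym (tpos _ p+2<n)) (ℕP.+-monoʳ-< p (s≤s (s≤s (s≤s z≤n)))))))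

    k≤m : k ≤ m
    k≤m = proj₂ mx k k≥1 k≤n (ℕP.≤-reflexive (esym dk))

    m≤ : m ≤ p + 3
    m≤ with m ≤? p + 3
    ... | yes q = q
    ... | no q = ⊥-elim (tooLarge m (proj₁ (proj₂ (proj₁ mx))) (proj₂ (proj₂ (proj₁ mx))) (ℕP.≰⇒> q))
      where
      tooLarge : ∀ m → m ≤ n → m ∸ 1 ≤ d m → p + 3 < m → ⊥
      tooLarge (suc m') mn mdm lt = ℕP.<⇒≱ (subst (_≤ m') (ℕP.+-suc p 2) (ℕP.≤-pred lt))
        (ℕP.≤-trans mdm (ℕP.≤-trans (ℕP.≤-reflexive (dpos m' mn))
          (ℕP.≤-trans (mono (f jm) (pos m' mn) (subst (p ≤_) (esym (tpos m' mn)) (ℕP.≤-trans (ℕP.m≤m+n p 3) (ℕP.≤-pred lt))))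
            (ℕP.≤-reflexive (trans (fA jm) k∸1≡)))))

    m≡ : m ≡ p + 3
    m≡ = ℕP.≤-antisym m≤ (subst (_≤ m) k≡ k≤m)

  result : ∀ m → IsMaxIndex n d m → ConditionI n d m × ConditionII n d m
  result m mx = subst (λ z → ConditionI n d z × ConditionII n d z) (esym (MaxIndex.m≡ m mx))
    ( Equivalence.from (conditionI⇔rows p p+5≤n) rows
    , Equivalence.from (conditionII⇔plateau p) (λ v → subst (λ δ → D v ≡ δ ⇔ (p ≤ toℕ v × toℕ v < p + 5)) k∸1≡ (plateau v)))

-- H is sorted and satisfies (i) and (ii) for
-- m = p + 3.  By (ii), [p, p + 5) is the plateau of degree p + 2.  Each
-- row below the cut p + 5 is at most its profile value, and (i) forces
-- equality with nothing above the cut: B is a clique joined to A, C is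
-- independent and anticomplete to A, and A is 2-regular, hence a 5-cycle.
module Backward {n} (H : Graph n) (d : ℕ → ℕ) (hd : ∀ (i : Fin n) → d (suc (toℕ i)) ≡ deg H i)
  (dmono : ∀ i j → 1 ≤ i → i ≤ j → j ≤ n → d j ≤ d i)
  (p : ℕ) (cI : ConditionI n d (p + 3)) (cII : ConditionII n d (p + 3)) where

  open Sorted H d hd dmono

  p+5≤n : p + 5 ≤ n
  p+5≤n = subst (_≤ n) (p+3+2≡p+5 p) (proj₁ cI)

  plateau : ∀ v → D v ≡ p + 2 ⇔ (p ≤ toℕ v × toℕ v < p + 5)
  plateau = Equivalence.to (conditionII⇔plateau p) cII

  Achar⇒ : ∀ v → D v ≡ p + 2 → p ≤ toℕ v × toℕ v < p + 5
  Achar⇒ v = Equivalence.to (plateau v)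

  Achar⇐ : ∀ v → p ≤ toℕ v → toℕ v < p + 5 → D v ≡ p + 2
  Achar⇐ v a b = Equivalence.from (plateau v) (a , b)

  open Plateau p (p + 2) p+5≤n plateau

  module RR = RowSplit (adj H) (Graph.sym H) (p + 5)

  rows : RowsI p p+5≤n
  rows = Equivalence.to (conditionI⇔rows p p+5≤n) cI

  -- each row below the cut is bounded by the profile: p + 4 for B (the
  -- other p + 4 positions), p + 2 = deg for A
  rowBelow≤profile : ∀ v → 𝟙 (RR.lt v) * RR.rowBelow v ≤ profile p v
  rowBelow≤profile v with toℕ v <? p
  ... | yes q rewrite t-ltb q | t-ltb {toℕ v} {p + 5} (ℕP.<-≤-trans q (ℕP.m≤m+n p 5)) =
        subst₂ _≤_ (esym (ℕP.+-identityʳ _)) (esym (trans (ℕP.+-identityʳ _) (ℕP.+-identityʳ _))) (ℕP.+-cancelʳ-≤ 1 (RR.rowBelow v) (p + 4)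
          (subst (RR.rowBelow v + 1 ≤_) (p+5≡p+4+1 p) (RR.rowBelow-bound (Graph.irrefl H) p+5≤n v (t-ltb (ℕP.<-≤-trans q (ℕP.m≤m+n p 5))))))
  ... | no q with toℕ v <? p + 5
  ...   | yes r rewrite f-ltb q | t-ltb r = ℕP.+-monoˡ-≤ 0
          (subst (RR.rowBelow v ≤_) (trans (esym (RR.dsplit v)) (trans (esym (Dd v)) (Achar⇐ v (ℕP.≮⇒≥ q) r)))
            (ℕP.m≤m+n (RR.rowBelow v) (RR.rowAbove v)))
  ...   | no r rewrite f-ltb q | f-ltb r = z≤n

  -- X + 10 = W + 10 + Y with X ≤ W forces X = W and Y = 0
  X Y W : ℕ
  X = ∑ (λ v → 𝟙 (RR.lt v) * RR.rowBelow v)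
  Y = ∑ (λ v → 𝟙 (RR.ge v) * RR.rowAbove v)
  W = p * (p + 4) + 5 * (p + 2)

  X≤W : X ≤ W
  X≤W = subst (X ≤_) (profile-sum p p+5≤n) (∑-mono rowBelow≤profile)

  X+10≡W+10+Y : X + 10 ≡ W + 10 + Y
  X+10≡W+10+Y = trans rows (cong (_+ Y) (rowTotal p))

  Y≡0 : Y ≡ 0
  Y≡0 = ℕP.n≤0⇒n≡0 (ℕP.+-cancelʳ-≤ (W + 10) Y 0
          (subst (_≤ W + 10) (trans X+10≡W+10+Y (ℕP.+-comm (W + 10) Y)) (ℕP.+-monoˡ-≤ 10 X≤W)))

  X≡W : X ≡ W
  X≡W = ℕP.+-cancelʳ-≡ 10 X W (trans X+10≡W+10+Y (trans (cong (W + 10 +_) Y≡0) (ℕP.+-identityʳ _)))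

  rowEq : ∀ v → 𝟙 (RR.lt v) * RR.rowBelow v ≡ profile p v
  rowEq = ∑-≤-≡⇒≡ rowBelow≤profile (trans X≡W (esym (profile-sum p p+5≤n)))

  rowAbove0 : ∀ v → 𝟙 (RR.ge v) * RR.rowAbove v ≡ 0
  rowAbove0 = ∑≡0⇒≡0 Y≡0

  𝟙≡0 : ∀ {b} → 𝟙 b ≡ 0 → b ≡ false
  𝟙≡0 {false} _ = refl

  geT : ∀ v → p + 5 ≤ toℕ v → RR.ge v ≡ true
  geT v hv rewrite f-ltb (ℕP.≤⇒≯ hv) = refl

  noneAbove : ∀ v → RR.rowAbove v ≡ 0 → ∀ w → p + 5 ≤ toℕ w → adj H v w ≡ false
  noneAbove v r0 w hw = 𝟙≡0 (trans (esym (ℕP.+-identityʳ _))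
    (subst (λ z → 𝟙 z * 𝟙 (adj H v w) ≡ 0) (geT w hw) (∑≡0⇒≡0 r0 w)))

  Cind : ∀ v w → p + 5 ≤ toℕ v → p + 5 ≤ toℕ w → adj H v w ≡ false
  Cind v w hv hw = noneAbove v (trans (esym (ℕP.+-identityʳ _))
    (subst (λ z → 𝟙 z * RR.rowAbove v ≡ 0) (geT v hv) (rowAbove0 v))) w hw

  Bfull : ∀ v → toℕ v < p → ∀ w → toℕ w < p + 5 → w ≢ v → adj H v w ≡ true
  Bfull v hv w hw ne = RR.rowBelow-full⁻ (Graph.irrefl H) p+5≤n v ltv full w (t-ltb hw) ne
    where
    ltv : RR.lt v ≡ true
    ltv = t-ltb (ℕP.<-≤-trans hv (ℕP.m≤m+n p 5))
    profileB : profile p v ≡ p + 4 + 0 + 0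
    profileB rewrite t-ltb hv = refl
    full : RR.rowBelow v + 1 ≡ p + 5
    full = trans (cong (_+ 1) (ℕP.+-cancelʳ-≡ 0 _ _
             (trans (subst (λ z → 𝟙 z * RR.rowBelow v ≡ profile p v) ltv (rowEq v)) (trans profileB (ℕP.+-identityʳ _)))))
             (esym (p+5≡p+4+1 p))

  -- vertices of A have p + 2 neighbours below the cut, hence none in C
  rowBelow-A : ∀ v → p ≤ toℕ v → toℕ v < p + 5 → RR.rowBelow v ≡ p + 2
  rowBelow-A v a b = ℕP.+-cancelʳ-≡ 0 _ _ (subst₂ (λ x y → 𝟙 y * RR.rowBelow v ≡ 𝟙 x * (p + 4) + (𝟙 (not x) * 𝟙 y) * (p + 2))
                       (f-ltb (ℕP.≤⇒≯ a)) (t-ltb {toℕ v} {p + 5} b) (rowEq v))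

  AnoC : ∀ v → p ≤ toℕ v → toℕ v < p + 5 → ∀ w → p + 5 ≤ toℕ w → adj H v w ≡ false
  AnoC v a b = noneAbove v (ℕP.+-cancelˡ-≡ (RR.rowBelow v) _ _ (trans (esym (RR.dsplit v))
    (trans (esym (Dd v)) (trans (Achar⇐ v a b) (trans (esym (rowBelow-A v a b)) (esym (ℕP.+-identityʳ _)))))))

  -- a vertex of A has p neighbours in B, hence exactly 2 in A
  degreeInA≡2 : ∀ v → p ≤ toℕ v → toℕ v < p + 5 → ∑ (λ w → 𝟙 (inInterval p 5 (toℕ w)) * 𝟙 (adj H v w)) ≡ 2
  degreeInA≡2 v a b = ℕP.+-cancelˡ-≡ p _ _ (trans (esym (cong (_+ neighboursInA) neighboursInB)) (trans (esym rowSplitAtp) rowA))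
    where
    rowA : RR.rowBelow v ≡ p + 2
    rowA = rowBelow-A v a b
    split : ∀ w → 𝟙 (RR.lt w) * 𝟙 (adj H v w) ≡ 𝟙 (ltb (toℕ w) p) * 𝟙 (adj H v w) + 𝟙 (inInterval p 5 (toℕ w)) * 𝟙 (adj H v w)
    split w with toℕ w <? p
    ... | yes q rewrite t-ltb q | t-ltb {toℕ w} {p + 5} (ℕP.<-≤-trans q (ℕP.m≤m+n p 5)) = esym (ℕP.+-identityʳ _)
    ... | no q with toℕ w <? p + 5
    ...   | yes r rewrite f-ltb q | t-ltb r | t-ltb {toℕ w ∸ p} {5} (subst (toℕ w ∸ p <_) (ℕP.m+n∸m≡n p 5) (ℕP.∸-monoˡ-< r (ℕP.≮⇒≥ q))) = refl
    ...   | no r rewrite f-ltb q | f-ltb r | f-ltb {toℕ w ∸ p} {5} (λ lt → r (subst (_< p + 5) (ℕP.m+[n∸m]≡n (ℕP.≮⇒≥ q)) (ℕP.+-monoʳ-< p lt))) = refl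
    neighboursInB : ∑ (λ w → 𝟙 (ltb (toℕ w) p) * 𝟙 (adj H v w)) ≡ p
    neighboursInB = trans (∑-cong pt) (count-below p (ℕP.≤-trans (ℕP.m≤m+n p 5) p+5≤n))
      where pt : ∀ w → 𝟙 (ltb (toℕ w) p) * 𝟙 (adj H v w) ≡ 𝟙 (ltb (toℕ w) p)
            pt w with toℕ w <? p
            ... | yes q = trans (cong₂ (λ x y → 𝟙 x * 𝟙 y) (t-ltb q)
                            (trans (Graph.sym H v w) (Bfull w q v b (λ e → ℕP.<⇒≱ q (subst (p ≤_) (cong toℕ e) a)))))
                            (esym (cong 𝟙 (t-ltb q)))
            ... | no q = trans (cong (λ x → 𝟙 x * 𝟙 (adj H v w)) (f-ltb q)) (esym (cong 𝟙 (f-ltb q)))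
    neighboursInA : ℕ
    neighboursInA = ∑ (λ w → 𝟙 (inInterval p 5 (toℕ w)) * 𝟙 (adj H v w))
    rowSplitAtp : RR.rowBelow v ≡ ∑ (λ w → 𝟙 (ltb (toℕ w) p) * 𝟙 (adj H v w)) + neighboursInA
    rowSplitAtp = trans (∑-cong {n} split) (∑-distrib-+ {n} (λ w → 𝟙 (ltb (toℕ w) p) * 𝟙 (adj H v w)) (λ w → 𝟙 (inInterval p 5 (toℕ w)) * 𝟙 (adj H v w)))

  -- the 5-cycle on A, found by recognising the 2-regular graph on the
  -- positions p, …, p + 4
  -- the vertex at position p + s
  posA : Fin 5 → Fin n
  posA s = fromℕ< (bnd p 5 p+5≤n s)

  tposA : ∀ s → toℕ (posA s) ≡ p + toℕ s
  tposA s = FP.toℕ-fromℕ< (bnd p 5 p+5≤n s)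

  posA-l : ∀ s → p ≤ toℕ (posA s)
  posA-l s = subst (p ≤_) (esym (tposA s)) (ℕP.m≤m+n p _)
  posA-r : ∀ s → toℕ (posA s) < p + 5
  posA-r s = subst (_< p + 5) (esym (tposA s)) (ℕP.+-monoʳ-< p (FP.toℕ<n s))

  adjA : Fin 5 → Fin 5 → Bool
  adjA s s' = adj H (posA s) (posA s')

  adjA-twoRegular : ∀ s → ∑ (λ s' → 𝟙 (adjA s s')) ≡ 2
  adjA-twoRegular s = trans (esym (∑-interval p 5 p+5≤n (λ w → 𝟙 (adj H (posA s) w)))) (degreeInA≡2 (posA s) (posA-l s) (posA-r s))

  iso : Σ (Fin 5 → Fin 5) λ π → Σ (Fin 5 → Fin 5) λ π' →
          (∀ i → π' (π i) ≡ i) × (∀ s → π (π' s) ≡ s) × (∀ i j → adjA (π i) (π j) ≡ c5adj i j)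
  iso = twoRegular⇒C5 adjA (λ i j → Graph.sym H _ _) (λ i → Graph.irrefl H _) adjA-twoRegular

  π π' : Fin 5 → Fin 5
  π = proj₁ iso
  π' = proj₁ (proj₂ iso)

  inv1 : ∀ i → π' (π i) ≡ i
  inv1 = proj₁ (proj₂ (proj₂ iso))
  inv2 : ∀ s → π (π' s) ≡ s
  inv2 = proj₁ (proj₂ (proj₂ (proj₂ iso)))

  fC : Fin 5 → Fin n
  fC i = posA (π i)

  fC-adj : ∀ i j → adj H (fC i) (fC j) ≡ c5adj i j
  fC-adj = proj₂ (proj₂ (proj₂ (proj₂ iso)))

  fC-inj : ∀ i j → fC i ≡ fC j → i ≡ j
  fC-inj i j e = trans (esym (inv1 i)) (trans (cong π' (FP.toℕ-injective (ℕP.+-cancelˡ-≡ p _ _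
                    (trans (esym (tposA (π i))) (trans (cong toℕ e) (tposA (π j))))))) (inv1 j))

  offsetInA : ∀ (v : Fin n) → p ≤ toℕ v → toℕ v < p + 5 → Fin 5
  offsetInA v a b = fromℕ< (subst (toℕ v ∸ p <_) (ℕP.m+n∸m≡n p 5) (ℕP.∸-monoˡ-< b a))

  fC-offset : ∀ (v : Fin n) a b → fC (π' (offsetInA v a b)) ≡ v
  fC-offset v a b = trans (cong posA (inv2 _)) (FP.toℕ-injective (trans (tposA _)
                  (trans (cong (p +_) (FP.toℕ-fromℕ< _)) (ℕP.m+[n∸m]≡n a))))

  fC-A : ∀ i → p ≤ toℕ (fC i) × toℕ (fC i) < p + 5
  fC-A i = posA-l (π i) , posA-r (π i)

  inA : ∀ v → p ≤ toℕ v → toℕ v < p + 5 → ∃ λ j → fC j ≡ v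
  inA v a b = π' (offsetInA v a b) , fC-offset v a b

  open Layout H p p+5≤n fC fC-inj fC-adj inA hiding (module RR)

  k+l : p + 3 + (N + 3) ≡ n + 1
  k+l = trans (rearrange p N) (cong (_+ 1) (esym n≡p+5+N))
    where rearrange : ∀ p N → p + 3 + (N + 3) ≡ p + 5 + N + 1
          rearrange = solve-∀

  smallG : ∀ v → GG.S v ≡ false → degOf (adj H) v < p + 3
  smallG = smallOutsideGG (λ v ge → ℕP.<-trans (belowC v ge) (ℕP.+-monoʳ-< p (s≤s (s≤s (s≤s z≤n)))))

  smallC : ∀ v → GC.S v ≡ false → degOf (complAdj H) v < N + 3
  smallC v e = ℕP.<-≤-trans (smallOutsideGC k+l (λ v lt → subst (_≤ D v) (esym (ℕP.+-suc p 2)) (aboveB v lt)) v e)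
                 (ℕP.m∸n≤m (N + 3) 1)

  colG : Colorable (adj H) (p + 3)
  colG = GG.colour-x+3 (p + 3) ℕP.≤-refl smallG

  colC : Colorable (complAdj H) (N + 3)
  colC = GC.colour-x+3 (N + 3) ℕP.≤-refl smallC

  -- lower bounds: the clique B (resp. C) joined to the 5-cycle on A
  eB : Fin p → Fin n
  eB s = fromℕ< (ℕP.<-≤-trans (FP.toℕ<n s) (ℕP.≤-trans (ℕP.m≤m+n p 5) p+5≤n))

  teB : ∀ s → toℕ (eB s) ≡ toℕ s
  teB s = FP.toℕ-fromℕ< _

  eB<p : ∀ s → toℕ (eB s) < p
  eB<p s = subst (_< p) (esym (teB s)) (FP.toℕ<n s)

  minG : ∀ j → Colorable (adj H) j → p + 3 ≤ j
  minG j (c , pc) = χ≥clique+C5 (adj H) eB fC cl fC-adj cm c pc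
    where
    cl : ∀ s s' → s ≢ s' → adj H (eB s) (eB s') ≡ true
    cl s s' ne = Bfull (eB s) (eB<p s) (eB s') (ℕP.<-≤-trans (eB<p s') (ℕP.m≤m+n p 5))
                   (λ e → ne (FP.toℕ-injective (trans (esym (teB s)) (trans (cong toℕ (esym e)) (teB s')))))
    cm : ∀ s j → adj H (eB s) (fC j) ≡ true
    cm s j = Bfull (eB s) (eB<p s) (fC j) (proj₂ (fC-A j))
               (λ e → ℕP.<⇒≱ (eB<p s) (subst (p ≤_) (cong toℕ e) (proj₁ (fC-A j))))

  bC : ∀ (s : Fin N) → p + 5 + toℕ s < n
  bC s = subst (p + 5 + toℕ s <_) (esym n≡p+5+N) (ℕP.+-monoʳ-< (p + 5) (FP.toℕ<n s))

  eC : Fin N → Fin n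
  eC s = fromℕ< (bC s)

  teC : ∀ s → toℕ (eC s) ≡ p + 5 + toℕ s
  teC s = FP.toℕ-fromℕ< (bC s)

  eC≥ : ∀ s → p + 5 ≤ toℕ (eC s)
  eC≥ s = subst (p + 5 ≤_) (esym (teC s)) (ℕP.m≤m+n (p + 5) _)

  cA-true : ∀ u w → eqb u w ≡ false → adj H u w ≡ false → complAdj H u w ≡ true
  cA-true u w e1 e2 = cong₂ (λ x y → not x ∧ not y) e1 e2

  minC : ∀ j → Colorable (complAdj H) j → N + 3 ≤ j
  minC j (c , pc) = χ≥clique+C5 (complAdj H) eC f' cl fa' cm c pc
    where
    cl : ∀ s s' → s ≢ s' → complAdj H (eC s) (eC s') ≡ true
    cl s s' ne = cA-true _ _ (dec-false (eC s FP.≟ eC s') (λ e → ne (FP.toℕ-injective (ℕP.+-cancelˡ-≡ (p + 5) _ _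
                   (trans (esym (teC s)) (trans (cong toℕ e) (teC s')))))))
                 (Cind (eC s) (eC s') (eC≥ s) (eC≥ s'))
    cm : ∀ s j → complAdj H (eC s) (f' j) ≡ true
    cm s j = cA-true _ _ (dec-false (eC s FP.≟ f' j) (λ e → ℕP.<⇒≱ (proj₂ (fC-A (c5Double j))) (subst (p + 5 ≤_) (cong toℕ e) (eC≥ s))))
               (trans (Graph.sym H _ _) (AnoC (f' j) (proj₁ (fC-A (c5Double j))) (proj₂ (fC-A (c5Double j))) (eC s) (eC≥ s)))

  p+3∸1≡p+2 : p + 3 ∸ 1 ≡ p + 2
  p+3∸1≡p+2 = cong (_∸ 1) (ℕP.+-suc p 2)

  ind5 : InducesC5 H (SetA H (p + 3))
  ind5 = fC , (λ {x} {y} e → fC-inj x y e) , (λ v → mk⇔ (to v) (from v)) , fC-adj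
    where
    to : ∀ v → SetA H (p + 3) v → ∃ λ i → fC i ≡ v
    to v e = π' (offsetInA v (proj₁ A) (proj₂ A)) , fC-offset v (proj₁ A) (proj₂ A)
      where A : p ≤ toℕ v × toℕ v < p + 5
            A = Achar⇒ v (trans e p+3∸1≡p+2)
    from : ∀ v → (∃ λ i → fC i ≡ v) → SetA H (p + 3) v
    from v (i , refl) = trans (Achar⇐ (fC i) (proj₁ (fC-A i)) (proj₂ (fC-A i))) (esym p+3∸1≡p+2)

  result : IsNG3 H
  result = (p + 3 , N + 3 , (colG , minG) , (colC , minC) , k+l) , (p + 3 , (colG , minG) , ind5)

noSuc : ∀ x → x + 1 ≤ 0 → ⊥
noSuc x h with subst (_≤ 0) (ℕP.+-comm x 1) h
... | ()

-- Conditions (i) and (ii) cannot hold with m ∈ {1, 2}: by (ii) the first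
-- m + 2 degrees equal m - 1 and all others vanish, and then (i) reads
-- (m + 2)(m - 1) + 10 = (m + 2)(m + 1), which fails for m = 1, 2.
module SmallIndex {n} (H : Graph n) (d : ℕ → ℕ) (hd : ∀ (i : Fin n) → d (suc (toℕ i)) ≡ deg H i)
  (dmono : ∀ i j → 1 ≤ i → i ≤ j → j ≤ n → d j ≤ d i)
  (m : ℕ) (m1 : 1 ≤ m) (m2 : m ≤ 2) (cI : ConditionI n d m) (cII : ConditionII n d m) where

  open Sorted H d hd dmono

  t : ℕ
  t = m + 2
  t≤n : t ≤ n
  t≤n = proj₁ cI

  cII' : ∀ v → (D v + 1 ≡ m) ⇔ (m ≤ suc (toℕ v) + 2 × suc (toℕ v) ≤ m + 2)
  cII' v = subst (λ z → (z + 1 ≡ m) ⇔ (m ≤ suc (toℕ v) + 2 × suc (toℕ v) ≤ m + 2)) (hd v) (cII (suc (toℕ v)) (s≤s z≤n) (FP.toℕ<n v))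

  m≤ : ∀ k → m ≤ suc k + 2
  m≤ k = ℕP.≤-trans m2 (ℕP.m≤n+m 2 (suc k))

  degreeInPrefix : ∀ v → toℕ v < t → D v + 1 ≡ m
  degreeInPrefix v lt = Equivalence.from (cII' v) (m≤ (toℕ v) , lt)

  b0 : 0 < n
  b0 = ℕP.≤-trans (ℕP.≤-trans m1 (ℕP.m≤m+n m 2)) t≤n
  v0 : Fin n
  v0 = pos 0 b0

  degreeBeyond : ∀ v → ¬ (toℕ v < t) → D v ≡ 0
  degreeBeyond v nlt = lessThanOne⇒0 (D v) m m2 (ℕP.≤∧≢⇒< le ne)
    where
    le : D v + 1 ≤ m
    le = subst (D v + 1 ≤_) (degreeInPrefix v0 (subst (_< t) (esym (tpos 0 b0)) (ℕP.≤-trans m1 (ℕP.m≤m+n m 2))))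
           (ℕP.+-monoˡ-≤ 1 (mono v0 v (subst (_≤ toℕ v) (esym (tpos 0 b0)) z≤n)))
    ne : D v + 1 ≢ m
    ne e = nlt (proj₂ (Equivalence.to (cII' v) e))
    lessThanOne⇒0 : ∀ x m → m ≤ 2 → x + 1 < m → x ≡ 0
    lessThanOne⇒0 zero m _ _ = refl
    lessThanOne⇒0 (suc x) (suc (suc (suc m))) (s≤s (s≤s ())) _
    lessThanOne⇒0 (suc x) (suc (suc zero)) _ (s≤s (s≤s h)) = ⊥-elim (noSuc x h)
    lessThanOne⇒0 (suc x) (suc zero) _ (s≤s ())
    lessThanOne⇒0 (suc x) zero _ ()

  module Cut = RowSplit (adj H) (Graph.sym H) t

  prefixSum : ∑ (λ v → 𝟙 (Cut.lt v) * degOf (adj H) v) ≡ t * (m ∸ 1)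
  prefixSum = trans (∑-cong pt) (trans (∑-*ʳ {n} (λ v → 𝟙 (Cut.lt v)) (m ∸ 1)) (cong (_* (m ∸ 1)) (count-below t t≤n)))
    where pt : ∀ v → 𝟙 (Cut.lt v) * degOf (adj H) v ≡ 𝟙 (Cut.lt v) * (m ∸ 1)
          pt v with toℕ v <? t
          ... | yes q = cong (𝟙 (Cut.lt v) *_) (trans (esym (Dd v)) (trans (esym (ℕP.m+n∸n≡m (D v) 1)) (cong (_∸ 1) (degreeInPrefix v q))))
          ... | no q = trans (cong (λ z → 𝟙 z * degOf (adj H) v) (f-ltb q)) (cong (λ z → 𝟙 z * (m ∸ 1)) (esym (f-ltb q)))

  suffixSum : ∑ (λ v → 𝟙 (Cut.ge v) * degOf (adj H) v) ≡ 0
  suffixSum = trans (∑-cong pt) (∑-zero {n})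
    where pt : ∀ v → 𝟙 (Cut.ge v) * degOf (adj H) v ≡ 0
          pt v with toℕ v <? t
          ... | yes q = cong (λ z → 𝟙 (not z) * degOf (adj H) v) (t-ltb q)
          ... | no q = trans (cong (𝟙 (Cut.ge v) *_) (trans (esym (Dd v)) (degreeBeyond v q))) (ℕP.*-zeroʳ (𝟙 (Cut.ge v)))

  m+3≡1+m+2 : m + 3 ≡ suc (m + 2)
  m+3≡1+m+2 = ℕP.+-suc m 2

  conditionI-small : t * (m ∸ 1) + 10 ≡ (m + 2) * (m + 1) + 0
  conditionI-small = begin
    t * (m ∸ 1) + 10 ≡⟨ cong (_+ 10) (esym prefixSum) ⟩
    ∑ (λ v → 𝟙 (Cut.lt v) * degOf (adj H) v) + 10 ≡⟨ cong (_+ 10) (esym (sumL t t≤n)) ⟩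
    sumFromTo d 1 (m + 2) + 10 ≡⟨ proj₂ cI ⟩
    (m + 2) * (m + 1) + sumFromTo d (m + 3) n ≡⟨ cong (λ z → (m + 2) * (m + 1) + sumFromTo d z n) m+3≡1+m+2 ⟩
    (m + 2) * (m + 1) + sumFromTo d (suc (m + 2)) n ≡⟨ cong ((m + 2) * (m + 1) +_) (trans (sumR t t≤n) suffixSum) ⟩
    (m + 2) * (m + 1) + 0 ∎
    where open ≡-Reasoning

  absurd : ⊥
  absurd = fails m m1 m2 conditionI-small
    where
    fails : ∀ m → 1 ≤ m → m ≤ 2 → (m + 2) * (m ∸ 1) + 10 ≡ (m + 2) * (m + 1) + 0 → ⊥
    fails (suc zero) _ _ ()
    fails (suc (suc zero)) _ _ ()
    fails (suc (suc (suc m))) _ (s≤s (s≤s ())) _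

-- Forward: take jm the vertex of A at
-- the lowest position; the χ in the NG-3 witness agrees with k since the
-- chromatic number is unique.  Backward: m ≥ 1 by definition, m ∈ {1, 2}
-- is impossible, so m = p + 3.
sortedCore : ∀ {n} (H : Graph n) (d : ℕ → ℕ) (hd : ∀ (i : Fin n) → d (suc (toℕ i)) ≡ deg H i)
  (dmono : ∀ i j → 1 ≤ i → i ≤ j → j ≤ n → d j ≤ d i) (m : ℕ) → IsMaxIndex n d m →
  IsNG3 H ⇔ (ConditionI n d m × ConditionII n d m)
sortedCore {n} H d hd dmono m mx = mk⇔ to from
  where
  to : IsNG3 H → ConditionI n d m × ConditionII n d m
  to ((k , l , χk , χl , kl) , (k' , χk' , (f , finj , fiff , fadj))) =
    Forward.result H d hd dmono k l χk χl kl f (λ i j e → finj e) fiff' fadj jm (argmin-minimal (toℕ ∘ f)) m mx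
    where
    k'≡k : k' ≡ k
    k'≡k = ℕP.≤-antisym (proj₂ χk' k (proj₁ χk)) (proj₂ χk k' (proj₁ χk'))
    fiff' : ∀ v → (deg H v ≡ k ∸ 1) ⇔ ∃ λ i → f i ≡ v
    fiff' v = subst (λ z → (deg H v ≡ z ∸ 1) ⇔ ∃ λ i → f i ≡ v) k'≡k (fiff v)
    jm : Fin 5
    jm = argmin (toℕ ∘ f)
  from : ConditionI n d m × ConditionII n d m → IsNG3 H
  from (cI , cII) = byIndex m (proj₁ (proj₁ mx)) cI cII
    where
    byIndex : ∀ m → 1 ≤ m → ConditionI n d m → ConditionII n d m → IsNG3 H
    byIndex (suc zero) m1 cI cII = ⊥-elim (SmallIndex.absurd H d hd dmono 1 m1 (s≤s z≤n) cI cII)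
    byIndex (suc (suc zero)) m1 cI cII = ⊥-elim (SmallIndex.absurd H d hd dmono 2 m1 (s≤s (s≤s z≤n)) cI cII)
    byIndex (suc (suc (suc p))) m1 cI cII =
      Backward.result H d hd dmono p (subst (ConditionI n d) e cI) (subst (ConditionII n d) e cII)
      where e : suc (suc (suc p)) ≡ p + 3
            e = ℕP.+-comm 3 p

-- Relabel G along the permutation σ of its degree sequence; the relabelled
-- graph is sorted, and being NG-3 is invariant under relabelling.
theorem3p9 : ∀ (n : ℕ) (G : Graph n) (d : ℕ → ℕ) (m : ℕ) →
    IsDegreeSequence G d → IsMaxIndex n d m →
    (IsNG3 G ⇔ (ConditionI n d m × ConditionII n d m))
theorem3p9 n G d m ((σ , dσ) , dmono) mx = sortedCore H d hd dmono m mx ⇔-∘ Relabel.equiv G σ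
  where
  H : Graph n
  H = relabel G σ
  hd : ∀ (i : Fin n) → d (suc (toℕ i)) ≡ deg H i
  hd i = trans (dσ i) (esym (Relabel.degH G σ i))
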